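{- For each integer $n\geqslant 10$, write $n=4s+\epsilon$ with $s$ an integer and $\epsilon\in\{0,1,2,3\}$. Then $$\vartheta(H_n)=\begin{cases}1, & n=4s;\\ (2s+1)\lambda, & n=4s+1;\\ -1, & n=4s+2;\\ -(2s+2)\lambda, & n=4s+3.\end{cases}$$
   Context: All graphs are finite, simple and undirected; $\phi(G,\lambda)=\det(\lambda I-A(G))$ is the adjacency characteristic polynomial, and the lowest term $\vartheta(G)$ is the nonzero monomial of lowest degree in $\phi(G,\lambda)$. For $r\geqslant 2$, $P_r$ is the path with vertices $0,1,\dots,r-1$ (consecutive integers adjacent). For $0<m_1<m_2<r-1$ and positive integers $n_1,n_2$, $P_{n_1,n_2;r}^{m_1,m_2}$ is obtained from $P_r$ by attaching at vertex $m_i$ a pendant path with $n_i$ edges ($i=1,2$). For $n\geqslant 10$, $H_n:=P_{2,2;n-4}^{2,n-7}$, a tree with $n$ vertices. -}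

module Defs where

open import Data.Nat as ℕ using (ℕ; zero; suc; _∸_; _<ᵇ_; _≡ᵇ_)
open import Data.Integer as ℤ using (ℤ; +_; -[1+_])
open import Data.Fin using (Fin; zero; suc; toℕ; punchIn)
open import Data.List using (List; []; _∷_; _++_; map; applyUpTo)
open import Data.Bool.ListAction using (any)
open import Data.Bool using (Bool; true; false; if_then_else_; _∧_; _∨_)
open import Data.Product using (_×_; _,_)
open import Data.Maybe using (Maybe; just; nothing)

-- Polynomials in λ with integer coefficients, as coefficient lists
-- (lowest degree first; trailing zeros allowed, not normalised).

Poly : Set
Poly = List ℤ

infixl 6 _⊕_
infixl 7 _⊛_

_⊕_ : Poly → Poly → Poly
[] ⊕ q = q
(a ∷ p) ⊕ [] = a ∷ p
(a ∷ p) ⊕ (b ∷ q) = (a ℤ.+ b) ∷ (p ⊕ q)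

scale : ℤ → Poly → Poly
scale c = map (c ℤ.*_)

_⊛_ : Poly → Poly → Poly
[] ⊛ q = []
(a ∷ p) ⊛ q = scale a q ⊕ (+ 0 ∷ (p ⊛ q))

const : ℤ → Poly
const c = c ∷ []

lam : Poly
lam = + 0 ∷ + 1 ∷ []

sumFin : ∀ {n} → (Fin n → Poly) → Poly
sumFin {zero} f = []
sumFin {suc n} f = f zero ⊕ sumFin (λ j → f (suc j))

sign : ℕ → ℤ
sign zero = + 1
sign (suc k) = ℤ.- sign k

det : ∀ n → (Fin n → Fin n → Poly) → Poly
det zero M = const (+ 1)
det (suc n) M =
  sumFin (λ j → scale (sign (toℕ j)) (M zero j ⊛ det n (λ i k → M (suc i) (punchIn j k))))

-- Finite simple graphs on vertex set {0,…,n-1}, given by an edge list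
-- of unordered pairs (adjacency is the symmetric closure).

record Graph : Set where
  constructor mkGraph
  field
    order : ℕ
    edges : List (ℕ × ℕ)
open Graph public

adjacent : Graph → ℕ → ℕ → Bool
adjacent G i j =
  any (λ { (a , b) → ((a ≡ᵇ i) ∧ (b ≡ᵇ j)) ∨ ((a ≡ᵇ j) ∧ (b ≡ᵇ i)) }) (edges G)

adjEntry : Graph → ℕ → ℕ → ℤ
adjEntry G i j = if adjacent G i j then + 1 else + 0

charMatrix : (G : Graph) → Fin (order G) → Fin (order G) → Poly
charMatrix G i j =
  (if toℕ i ≡ᵇ toℕ j then lam else []) ⊕ const (ℤ.- adjEntry G (toℕ i) (toℕ j))

charPoly : Graph → Poly
charPoly G = det (order G) (charMatrix G)

lowestFrom : ℕ → Poly → Maybe (ℤ × ℕ)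
lowestFrom d [] = nothing
lowestFrom d (+ zero ∷ p) = lowestFrom (suc d) p
lowestFrom d (c@(+ suc _) ∷ p) = just (c , d)
lowestFrom d (c@(-[1+ _ ]) ∷ p) = just (c , d)

lowestTerm : Poly → Maybe (ℤ × ℕ)
lowestTerm = lowestFrom 0

-- P_r has vertices 0,…,r-1 with edges k ~ k+1.
-- P^{m1,m2}_{n1,n2;r}: the pendant path at m1 has new vertices
-- r, …, r+n1-1 with edges m1 ~ r, r+k ~ r+k+1; the pendant path at m2
-- has new vertices r+n1, …, r+n1+n2-1 with edges m2 ~ r+n1,
-- r+n1+k ~ r+n1+k+1.

pathEdges : ℕ → ℕ → List (ℕ × ℕ)
pathEdges start len = applyUpTo (λ k → (start ℕ.+ k , start ℕ.+ suc k)) (len ∸ 1)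

pendantEdges : ℕ → ℕ → ℕ → List (ℕ × ℕ)
pendantEdges m start zero = []
pendantEdges m start (suc n) = (m , start) ∷ pathEdges start (suc n)

P2 : (n1 n2 r m1 m2 : ℕ) → Graph
P2 n1 n2 r m1 m2 =
  mkGraph (r ℕ.+ n1 ℕ.+ n2)
    (pathEdges 0 r ++ pendantEdges m1 r n1 ++ pendantEdges m2 (r ℕ.+ n1) n2)

H : ℕ → Graph
H n = P2 2 2 (n ∸ 4) 2 (n ∸ 7)

-- Only the two lowest coefficients of φ(H_n) matter, so we compute φ modulo λ², i.e. the
-- determinant of λI − A over the dual numbers ℤ[ε], ε² = 0. Expanding along a pendant vertex v
-- with neighbour u gives φ(G) = λ φ(G − v) − φ(G − v − u), and a vertex without neighbours
-- contributes a factor λ. Peeling the four vertices of the two pendant paths of H_n, and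
-- splitting what remains into paths, gives
--   φ(H_n) ≡ φ(P_{n−4}) + λ (φ(P_{n−7}) φ(P_2) + φ(P_2) φ(P_{n−7}))  ≡  φ(P_{n−4}) − 2λ φ(P_{n−7})
-- modulo λ², since φ(P_2) = λ² − 1. By φ(P_{k+2}) = λ φ(P_{k+1}) − φ(P_k) the paths modulo λ²
-- run through 1, (2q+1)λ, −1, −(2q+2)λ for k = 4q, …, 4q + 3, which gives the four cases.

module Submission where

open import Algebra.Bundles using (CommutativeRing)
import Algebra.Structures as Structures
open import Data.Bool using (Bool; true; false; T; if_then_else_; _∧_; _∨_)
open import Data.Bool.Properties using (T-∨; T-∧; T-≡)
open import Data.Empty using (⊥; ⊥-elim)
open import Data.Fin using (Fin; zero; suc; toℕ; punchIn; inject₁; fromℕ; fromℕ<)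
open import Data.Fin.Properties
  using ( toℕ-inject₁; toℕ-fromℕ; toℕ-fromℕ<; toℕ<n; toℕ-injective; ≤fromℕ; punchInᵢ≢i; punchIn-injective
        ; fromℕ≢inject₁; inject₁-injective)
import Data.Integer.Properties as ℤP
open import Data.Integer.Tactic.RingSolver using (solve-∀)
open import Data.List using ([]; _∷_; _++_; drop)
open import Data.List.Membership.Propositional using (_∈_)
open import Data.List.Membership.Propositional.Properties using (∈-++⁺ˡ; ∈-++⁺ʳ; ∈-++⁻; ∈-applyUpTo⁺; ∈-applyUpTo⁻)
open import Data.List.Relation.Unary.Any as Any using (here; there)
open import Data.List.Relation.Unary.Any.Properties using (any⁺; any⁻; Any-⊎⁺; Any-⊎⁻)
open import Data.Maybe using (Maybe; just; nothing)
open import Data.Nat as ℕ using (ℕ; zero; suc; _<_; _≤_; _≡ᵇ_; z≤n; s≤s)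
import Data.Nat.Properties as ℕP
import Data.Nat.Tactic.RingSolver as ℕ-Solver
open import Data.Product using (_×_; _,_)
open import Data.Sum as Sum using (_⊎_; inj₁; inj₂)
open import Function using (id; _∘_; _⇔_; mk⇔; Equivalence; case_of_)
open import Level using (0ℓ)
open import Relation.Binary.Core using (_⇒_)
open import Relation.Binary.PropositionalEquality
open import Relation.Nullary using (¬_; Dec; yes; no)
open import Relation.Nullary.Decidable using (from-no)
import Tactic.RingSolver.Core.AlmostCommutativeRing as ACR
import Tactic.RingSolver.NonReflective as RingSolver

-- Laplace expansion over a commutative ring

punchIn-fromℕ : ∀ {n} (i : Fin n) → punchIn (fromℕ n) i ≡ inject₁ i
punchIn-fromℕ zero = refl
punchIn-fromℕ (suc i) = cong suc (punchIn-fromℕ i)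

punchIn-inject₁-fromℕ : ∀ {n} (i : Fin (suc n)) → punchIn (inject₁ i) (fromℕ n) ≡ fromℕ (suc n)
punchIn-inject₁-fromℕ {n} zero = refl
punchIn-inject₁-fromℕ {suc n} (suc i) = cong suc (punchIn-inject₁-fromℕ i)

punchIn-inject₁-inject₁ : ∀ {n} (i : Fin (suc n)) (j : Fin n) →
  punchIn (inject₁ i) (inject₁ j) ≡ inject₁ (punchIn i j)
punchIn-inject₁-inject₁ zero j = refl
punchIn-inject₁-inject₁ (suc i) zero = refl
punchIn-inject₁-inject₁ (suc i) (suc j) = cong suc (punchIn-inject₁-inject₁ i j)

module Determinant (R : CommutativeRing 0ℓ 0ℓ) (≈⇒≡ : CommutativeRing._≈_ R ⇒ _≡_) where

  open CommutativeRing R renaming (refl to ≈-refl) hiding (sym; trans; zero)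

  open import Algebra.Properties.Semiring.Sum semiring
    using (sum; sum-cong-≗; sum-replicate-zero; sum-remove; sum-init-last; ∑-comm; *-distribˡ-sum)
  open import Algebra.Properties.Ring ring using (-‿involutive; -‿distribˡ-*; -‿distribʳ-*)
  open import Algebra.Solver.CommutativeMonoid *-commutativeMonoid using (solve; _⊜_) renaming (_⊕_ to _·_)

  Matrix : ℕ → Set
  Matrix n = Fin n → Fin n → Carrier

  sgn : ℕ → Carrier
  sgn zero = 1#
  sgn (suc k) = - sgn k

  minor : ∀ {n} → Matrix (suc n) → Fin (suc n) → Fin (suc n) → Matrix n
  minor M i j k l = M (punchIn i k) (punchIn j l)

  det : ∀ n → Matrix n → Carrier
  det zero M = 1#
  det (suc n) M = sum λ j → sgn (toℕ j) * (M zero j * det n (minor M zero j))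

  det-cong : ∀ n {M N : Matrix n} → (∀ i j → M i j ≡ N i j) → det n M ≡ det n N
  det-cong zero M≗N = refl
  det-cong (suc n) M≗N = sum-cong-≗ λ j →
    cong₂ (λ a d → sgn (toℕ j) * (a * d)) (M≗N zero j) (det-cong n λ k l → M≗N (suc k) (punchIn j l))

  sgn-+-suc : ∀ k m → sgn (suc k ℕ.+ suc m) ≡ sgn (k ℕ.+ m)
  sgn-+-suc k m = trans (cong (sgn ∘ suc) (ℕP.+-suc k m)) (≈⇒≡ (-‿involutive (sgn (k ℕ.+ m))))

  sgn-+-self : ∀ m → sgn (m ℕ.+ m) ≡ 1#
  sgn-+-self zero = refl
  sgn-+-self (suc m) = trans (sgn-+-suc m m) (sgn-+-self m)

  sgn-fromℕ-+-self : ∀ m → sgn (toℕ (fromℕ m) ℕ.+ m) ≡ 1#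
  sgn-fromℕ-+-self m = trans (cong (λ i → sgn (i ℕ.+ m)) (toℕ-fromℕ m)) (sgn-+-self m)

  sgn-*-sgn : ∀ k → sgn k * sgn k ≡ 1#
  sgn-*-sgn zero = ≈⇒≡ (*-identityˡ 1#)
  sgn-*-sgn (suc k) = trans (≈⇒≡ (-‿*-‿ (sgn k) (sgn k))) (sgn-*-sgn k)
    where
    -‿*-‿ : ∀ a b → - a * - b ≈ a * b
    -‿*-‿ a b = R.trans (R.sym (-‿distribˡ-* a (- b)))
      (R.trans (-‿cong (R.sym (-‿distribʳ-* a b))) (-‿involutive (a * b)))
      where module R = CommutativeRing R

  sum-zero : ∀ {n} (f : Fin n → Carrier) → (∀ i → f i ≡ 0#) → sum f ≡ 0#
  sum-zero {n} f f≗0 = trans (sum-cong-≗ f≗0) (≈⇒≡ (sum-replicate-zero n))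

  sum-single : ∀ {n} (f : Fin n → Carrier) i → (∀ j → j ≢ i → f j ≡ 0#) → sum f ≡ f i
  sum-single {suc n} f i others≡0 = begin
    sum f                         ≡⟨ ≈⇒≡ (sum-remove f) ⟩
    f i + sum (f ∘ punchIn i)     ≡⟨ cong (f i +_) (sum-zero _ λ j → others≡0 (punchIn i j) (punchInᵢ≢i i j)) ⟩
    f i + 0#                      ≡⟨ ≈⇒≡ (+-identityʳ (f i)) ⟩
    f i                           ∎
    where open ≡-Reasoning

  *-distribˡ-sum₂ : ∀ {n} x y (f : Fin n → Carrier) → x * (y * sum f) ≡ sum λ k → x * (y * f k)
  *-distribˡ-sum₂ x y f = trans (cong (x *_) (≈⇒≡ (*-distribˡ-sum y f))) (≈⇒≡ (*-distribˡ-sum x λ k → y * f k))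

  *-swap-pairs : ∀ s a t b x → s * (a * (t * (b * x))) ≡ t * (b * (s * (a * x)))
  *-swap-pairs s a t b x = ≈⇒≡ (solve 5 (λ s a t b x → s · a · t · b · x ⊜ t · b · s · a · x) ≈-refl s a t b x)

  sum-exchange : ∀ {m n} (s s′ a : Fin m → Carrier) (t t′ b : Fin n → Carrier) (f : Fin m → Fin n → Carrier) →
    (∀ j k → s j * (a j * (t k * (b k * f j k))) ≡ t′ k * (b k * (s′ j * (a j * f j k)))) →
    sum (λ j → s j * (a j * sum λ k → t k * (b k * f j k)))
      ≡ sum (λ k → t′ k * (b k * sum λ j → s′ j * (a j * f j k)))
  sum-exchange s s′ a t t′ b f eq = begin
    sum (λ j → s j * (a j * sum λ k → t k * (b k * f j k)))
      ≡⟨ sum-cong-≗ (λ j → *-distribˡ-sum₂ (s j) (a j) λ k → t k * (b k * f j k)) ⟩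
    sum (λ j → sum λ k → s j * (a j * (t k * (b k * f j k))))
      ≡⟨ sum-cong-≗ (λ j → sum-cong-≗ (eq j)) ⟩
    sum (λ j → sum λ k → t′ k * (b k * (s′ j * (a j * f j k))))
      ≡⟨ ≈⇒≡ (∑-comm λ j k → t′ k * (b k * (s′ j * (a j * f j k)))) ⟩
    sum (λ k → sum λ j → t′ k * (b k * (s′ j * (a j * f j k))))
      ≡⟨ sum-cong-≗ (λ k → *-distribˡ-sum₂ (t′ k) (b k) λ j → s′ j * (a j * f j k)) ⟨
    sum (λ k → t′ k * (b k * sum λ j → s′ j * (a j * f j k)))
      ∎
    where open ≡-Reasoning

  det-expand-col0 : ∀ n (M : Matrix (suc n)) →
    det (suc n) M ≡ sum λ i → sgn (toℕ i) * (M i zero * det n (minor M i zero))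
  det-expand-col0 zero M = refl
  det-expand-col0 (suc n) M = cong (sgn 0 * (M zero zero * det (suc n) (minor M zero zero)) +_) (begin
      sum (λ j → sgn (suc (toℕ j)) * (M zero (suc j) * det (suc n) (minor M zero (suc j))))
    ≡⟨ sum-cong-≗ (λ j → cong (λ d → sgn (suc (toℕ j)) * (M zero (suc j) * d))
                               (det-expand-col0 n (minor M zero (suc j)))) ⟩
      sum (λ j → sgn (suc (toℕ j)) * (M zero (suc j) * sum λ k → sgn (toℕ k) * (M (suc k) zero * X j k)))
    ≡⟨ sum-exchange (λ j → sgn (suc (toℕ j))) (λ j → sgn (toℕ j)) (λ j → M zero (suc j))
                    (λ k → sgn (toℕ k)) (λ k → sgn (suc (toℕ k))) (λ k → M (suc k) zero) X
                    (λ j k → exchange (sgn (toℕ j)) _ (sgn (toℕ k)) _ (X j k)) ⟩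
      sum (λ k → sgn (suc (toℕ k)) * (M (suc k) zero * sum λ j → sgn (toℕ j) * (M zero (suc j) * X j k)))
    ∎)
    where
    open ≡-Reasoning
    X : Fin (suc n) → Fin (suc n) → Carrier
    X j k = det n (minor (minor M zero (suc j)) k zero)
    exchange : ∀ s a t b x → - s * (a * (t * (b * x))) ≡ - t * (b * (s * (a * x)))
    exchange s a t b x = trans (sym (≈⇒≡ (-‿distribˡ-* s _)))
      (trans (cong -_ (*-swap-pairs s a t b x)) (≈⇒≡ (-‿distribˡ-* t _)))

  det-transpose : ∀ n (M : Matrix n) → det n (λ i j → M j i) ≡ det n M
  det-transpose zero M = refl
  det-transpose (suc n) M = trans
    (sum-cong-≗ λ j → cong (λ d → sgn (toℕ j) * (M j zero * d)) (det-transpose n (minor M j zero)))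
    (sym (det-expand-col0 n M))

  det-expand-lastCol : ∀ n (M : Matrix (suc n)) →
    det (suc n) M ≡ sum λ i → sgn (toℕ i ℕ.+ n) * (M i (fromℕ n) * det n (minor M i (fromℕ n)))
  det-expand-lastCol zero M = refl
  det-expand-lastCol (suc m) M = begin
      det (suc (suc m)) M
    ≡⟨ ≈⇒≡ (sum-init-last rowTerm) ⟩
      sum (rowTerm ∘ inject₁) + rowTerm L
    ≡⟨ cong₂ _+_ inner lastTerm ⟩
      sum (colTerm ∘ suc) + colTerm zero
    ≡⟨ ≈⇒≡ (+-comm _ _) ⟩
      sum colTerm
    ∎
    where
    open ≡-Reasoning
    L = fromℕ (suc m)
    rowTerm colTerm : Fin (suc (suc m)) → Carrier
    rowTerm j = sgn (toℕ j) * (M zero j * det (suc m) (minor M zero j))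
    colTerm k = sgn (toℕ k ℕ.+ suc m) * (M k L * det (suc m) (minor M k L))
    X : Fin (suc m) → Fin (suc m) → Carrier
    X j k = det m λ p q → M (suc (punchIn k p)) (inject₁ (punchIn j q))
    lastTerm : rowTerm L ≡ colTerm zero
    lastTerm = cong (λ i → sgn i * (M zero L * det (suc m) (minor M zero L))) (toℕ-fromℕ (suc m))
    inner : sum (rowTerm ∘ inject₁) ≡ sum (colTerm ∘ suc)
    inner = begin
        sum (rowTerm ∘ inject₁)
      ≡⟨ sum-cong-≗ (λ j → cong₂ (λ s d → s * (M zero (inject₁ j) * d)) (cong sgn (toℕ-inject₁ j))
           (trans (det-expand-lastCol m (minor M zero (inject₁ j))) (sum-cong-≗ λ k →
             cong₂ (λ c d → sgn (toℕ k ℕ.+ m) * (M (suc k) c * d)) (punchIn-inject₁-fromℕ j)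
               (det-cong m λ p q → cong (M (suc (punchIn k p)))
                 (trans (cong (punchIn (inject₁ j)) (punchIn-fromℕ q)) (punchIn-inject₁-inject₁ j q)))))) ⟩
        sum (λ j → sgn (toℕ j) * (M zero (inject₁ j) * sum λ k → sgn (toℕ k ℕ.+ m) * (M (suc k) L * X j k)))
      ≡⟨ sum-exchange (λ j → sgn (toℕ j)) (λ j → sgn (toℕ j)) (λ j → M zero (inject₁ j))
           (λ k → sgn (toℕ k ℕ.+ m)) (λ k → sgn (toℕ k ℕ.+ m)) (λ k → M (suc k) L) X
           (λ j k → *-swap-pairs _ _ _ _ (X j k)) ⟩
        sum (λ k → sgn (toℕ k ℕ.+ m) * (M (suc k) L * sum λ j → sgn (toℕ j) * (M zero (inject₁ j) * X j k)))
      ≡⟨ sum-cong-≗ (λ k → cong₂ (λ s d → s * (M (suc k) L * d)) (sgn-+-suc (toℕ k) m)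
           (sum-cong-≗ λ j → cong₂ (λ c d → sgn (toℕ j) * (M zero c * d)) (punchIn-fromℕ j)
             (det-cong m λ p q → cong (M (suc (punchIn k p))) (punchIn-fromℕ (punchIn j q))))) ⟨
        sum (colTerm ∘ suc)
      ∎

  det-expand-lastRow : ∀ n (M : Matrix (suc n)) →
    det (suc n) M ≡ sum λ j → sgn (toℕ j ℕ.+ n) * (M (fromℕ n) j * det n (minor M (fromℕ n) j))
  det-expand-lastRow n M = begin
    det (suc n) M                ≡⟨ det-transpose (suc n) M ⟨
    det (suc n) (λ i j → M j i)  ≡⟨ det-expand-lastCol n (λ i j → M j i) ⟩
    sum (λ j → sgn (toℕ j ℕ.+ n) * (M (fromℕ n) j * det n (λ p q → M (punchIn (fromℕ n) q) (punchIn j p))))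
      ≡⟨ sum-cong-≗ (λ j → cong (λ d → sgn (toℕ j ℕ.+ n) * (M (fromℕ n) j * d))
                               (det-transpose n (minor M (fromℕ n) j))) ⟩
    sum (λ j → sgn (toℕ j ℕ.+ n) * (M (fromℕ n) j * det n (minor M (fromℕ n) j)))  ∎
    where open ≡-Reasoning

  *-vanishes : ∀ s {a} d → a ≡ 0# → s * (a * d) ≡ 0#
  *-vanishes s d refl = trans (cong (s *_) (≈⇒≡ (zeroˡ d))) (≈⇒≡ (zeroʳ s))

  det-single-lastCol : ∀ m (M : Matrix (suc m)) u → (∀ i → i ≢ u → M i (fromℕ m) ≡ 0#) →
    det (suc m) M ≡ sgn (toℕ u ℕ.+ m) * (M u (fromℕ m) * det m (minor M u (fromℕ m)))
  det-single-lastCol m M u col≡0 = trans (det-expand-lastCol m M)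
    (sum-single _ u λ i i≢u → *-vanishes (sgn (toℕ i ℕ.+ m)) (det m (minor M i (fromℕ m))) (col≡0 i i≢u))

  det-isolated-last : ∀ m (M : Matrix (suc m)) → (∀ j → j ≢ fromℕ m → M (fromℕ m) j ≡ 0#) →
    det (suc m) M ≡ M (fromℕ m) (fromℕ m) * det m (minor M (fromℕ m) (fromℕ m))
  det-isolated-last m M row≡0 = begin
    det (suc m) M
      ≡⟨ det-expand-lastRow m M ⟩
    sum (λ j → sgn (toℕ j ℕ.+ m) * (M L j * det m (minor M L j)))
      ≡⟨ sum-single _ L (λ j j≢L → *-vanishes (sgn (toℕ j ℕ.+ m)) (det m (minor M L j)) (row≡0 j j≢L)) ⟩
    sgn (toℕ L ℕ.+ m) * (M L L * det m (minor M L L))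
      ≡⟨ cong (_* (M L L * det m (minor M L L))) (sgn-fromℕ-+-self m) ⟩
    1# * (M L L * det m (minor M L L))
      ≡⟨ ≈⇒≡ (*-identityˡ _) ⟩
    M L L * det m (minor M L L)
      ∎
    where
    open ≡-Reasoning
    L = fromℕ m

  det-pendant-last : ∀ m (M : Matrix (suc (suc m))) (u : Fin (suc m)) →
    (∀ j → j ≢ fromℕ (suc m) → j ≢ inject₁ u → M (fromℕ (suc m)) j ≡ 0#) →
    (∀ i → i ≢ fromℕ (suc m) → i ≢ inject₁ u → M i (fromℕ (suc m)) ≡ 0#) →
    det (suc (suc m)) M ≡
      M (fromℕ (suc m)) (fromℕ (suc m)) * det (suc m) (minor M (fromℕ (suc m)) (fromℕ (suc m)))
      - M (fromℕ (suc m)) (inject₁ u) * M (inject₁ u) (fromℕ (suc m))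
        * det m (minor (minor M (fromℕ (suc m)) (fromℕ (suc m))) u u)
  det-pendant-last m M u row≡0 col≡0 = begin
      det (suc (suc m)) M
    ≡⟨ det-expand-lastRow (suc m) M ⟩
      sum F
    ≡⟨ ≈⇒≡ (sum-init-last F) ⟩
      sum (F ∘ inject₁) + F L
    ≡⟨ cong (_+ F L) (sum-single (F ∘ inject₁) u λ k k≢u →
         *-vanishes (sgn (toℕ (inject₁ k) ℕ.+ suc m)) (det (suc m) (minor M L (inject₁ k)))
           (row≡0 (inject₁ k) (fromℕ≢inject₁ ∘ sym) (k≢u ∘ inject₁-injective))) ⟩
      F (inject₁ u) + F L
    ≡⟨ cong₂ _+_ (cong₂ (λ s d → s * (a * d)) sgn-u detN) lastTerm ⟩
      - s * (a * (s * (b * X))) + l * Y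
    ≡⟨ cong (_+ l * Y) (trans (sym (≈⇒≡ (-‿distribˡ-* s _))) (cong -_ square)) ⟩
      - (a * b * X) + l * Y
    ≡⟨ ≈⇒≡ (+-comm _ _) ⟩
      l * Y - a * b * X
    ∎
    where
    open ≡-Reasoning
    L = fromℕ (suc m)
    F : Fin (suc (suc m)) → Carrier
    F k = sgn (toℕ k ℕ.+ suc m) * (M L k * det (suc m) (minor M L k))
    a = M L (inject₁ u)
    b = M (inject₁ u) L
    l = M L L
    s = sgn (toℕ u ℕ.+ m)
    X = det m (minor (minor M L L) u u)
    Y = det (suc m) (minor M L L)
    N = minor M L (inject₁ u)
    entry : ∀ k → N k (fromℕ m) ≡ M (inject₁ k) L
    entry k = cong₂ M (punchIn-fromℕ k) (punchIn-inject₁-fromℕ u)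
    detN : det (suc m) N ≡ s * (b * X)
    detN = begin
      det (suc m) N
        ≡⟨ det-single-lastCol m N u (λ k k≢u →
             trans (entry k) (col≡0 (inject₁ k) (fromℕ≢inject₁ ∘ sym) (k≢u ∘ inject₁-injective))) ⟩
      s * (N u (fromℕ m) * det m (minor N u (fromℕ m)))
        ≡⟨ cong₂ (λ c d → s * (c * d)) (entry u) (det-cong m λ p q → cong (M (punchIn L (punchIn u p)))
             (trans (cong (punchIn (inject₁ u)) (punchIn-fromℕ q))
               (trans (punchIn-inject₁-inject₁ u q) (sym (punchIn-fromℕ (punchIn u q)))))) ⟩
      s * (b * X)
        ∎
    sgn-u : sgn (toℕ (inject₁ u) ℕ.+ suc m) ≡ - s
    sgn-u = cong sgn (trans (cong (ℕ._+ suc m) (toℕ-inject₁ u)) (ℕP.+-suc (toℕ u) m))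
    lastTerm : F L ≡ l * Y
    lastTerm = trans (cong (_* (l * Y)) (sgn-fromℕ-+-self (suc m))) (≈⇒≡ (*-identityˡ (l * Y)))
    square : s * (a * (s * (b * X))) ≡ a * b * X
    square = begin
      s * (a * (s * (b * X)))
        ≡⟨ ≈⇒≡ (solve 4 (λ s a b x → s · a · s · b · x ⊜ (s · s) · ((a · b) · x)) ≈-refl s a b X) ⟩
      (s * s) * (a * b * X)    ≡⟨ cong (_* (a * b * X)) (sgn-*-sgn (toℕ u ℕ.+ m)) ⟩
      1# * (a * b * X)         ≡⟨ ≈⇒≡ (*-identityˡ _) ⟩
      a * b * X                ∎

-- Opened only here, as Determinant declares or uses the same names.
open import Defs
open import Data.Integer as ℤ using (ℤ; +_; -_; -[1+_])
open import Data.Nat using (_+_; _*_)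

-- Dual numbers and polynomials modulo λ²

record Dual : Set where
  constructor dual
  field
    c₀ c₁ : ℤ
open Dual

infixl 6 _+ᴰ_ _-ᴰ_
infixl 7 _*ᴰ_
infix 8 -ᴰ_

_+ᴰ_ : Dual → Dual → Dual
dual a b +ᴰ dual c d = dual (a ℤ.+ c) (b ℤ.+ d)

_*ᴰ_ : Dual → Dual → Dual
dual a b *ᴰ dual c d = dual (a ℤ.* c) (a ℤ.* d ℤ.+ b ℤ.* c)

-ᴰ_ : Dual → Dual
-ᴰ dual a b = dual (ℤ.- a) (ℤ.- b)

_-ᴰ_ : Dual → Dual → Dual
x -ᴰ y = x +ᴰ -ᴰ y

0ᴰ 1ᴰ ε : Dual
0ᴰ = dual (+ 0) (+ 0)
1ᴰ = dual (+ 1) (+ 0)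
ε = dual (+ 0) (+ 1)

dual-isCommutativeRing : Structures.IsCommutativeRing {A = Dual} _≡_ _+ᴰ_ _*ᴰ_ -ᴰ_ 0ᴰ 1ᴰ
dual-isCommutativeRing = record
  { isRing = record
    { +-isAbelianGroup = record
      { isGroup = record
        { isMonoid = record
          { isSemigroup = record
            { isMagma = record { isEquivalence = isEquivalence ; ∙-cong = cong₂ _+ᴰ_ }
            ; assoc = λ { (dual a b) (dual c d) (dual e f) → cong₂ dual (ℤP.+-assoc a c e) (ℤP.+-assoc b d f) } }
          ; identity = (λ { (dual a b) → cong₂ dual (ℤP.+-identityˡ a) (ℤP.+-identityˡ b) })
                     , (λ { (dual a b) → cong₂ dual (ℤP.+-identityʳ a) (ℤP.+-identityʳ b) }) }
        ; inverse = (λ { (dual a b) → cong₂ dual (ℤP.+-inverseˡ a) (ℤP.+-inverseˡ b) })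
                  , (λ { (dual a b) → cong₂ dual (ℤP.+-inverseʳ a) (ℤP.+-inverseʳ b) })
        ; ⁻¹-cong = cong (λ x → -ᴰ x) }
      ; comm = λ { (dual a b) (dual c d) → cong₂ dual (ℤP.+-comm a c) (ℤP.+-comm b d) } }
    ; *-cong = cong₂ _*ᴰ_
    ; *-assoc = λ { (dual a b) (dual c d) (dual e f) → cong₂ dual (ℤP.*-assoc a c e) (*-assoc₁ a b c d e f) }
    ; *-identity = (λ { (dual a b) → cong₂ dual (ℤP.*-identityˡ a) (*-identityˡ₁ a b) })
                 , (λ { (dual a b) → cong₂ dual (ℤP.*-identityʳ a) (*-identityʳ₁ a b) })
    ; distrib = (λ { (dual a b) (dual c d) (dual e f) → cong₂ dual (ℤP.*-distribˡ-+ a c e) (distribˡ₁ a b c d e f) })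
              , (λ { (dual a b) (dual c d) (dual e f) → cong₂ dual (ℤP.*-distribʳ-+ a c e) (distribʳ₁ a b c d e f) }) }
  ; *-comm = λ { (dual a b) (dual c d) → cong₂ dual (ℤP.*-comm a c) (*-comm₁ a b c d) } }
  where
  *-assoc₁ : ∀ a b c d e f →
    (a ℤ.* c) ℤ.* f ℤ.+ (a ℤ.* d ℤ.+ b ℤ.* c) ℤ.* e ≡ a ℤ.* (c ℤ.* f ℤ.+ d ℤ.* e) ℤ.+ b ℤ.* (c ℤ.* e)
  *-assoc₁ = solve-∀
  *-identityˡ₁ : ∀ a b → + 1 ℤ.* b ℤ.+ + 0 ℤ.* a ≡ b
  *-identityˡ₁ = solve-∀
  *-identityʳ₁ : ∀ a b → a ℤ.* + 0 ℤ.+ b ℤ.* + 1 ≡ b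
  *-identityʳ₁ = solve-∀
  distribˡ₁ : ∀ a b c d e f →
    a ℤ.* (d ℤ.+ f) ℤ.+ b ℤ.* (c ℤ.+ e) ≡ (a ℤ.* d ℤ.+ b ℤ.* c) ℤ.+ (a ℤ.* f ℤ.+ b ℤ.* e)
  distribˡ₁ = solve-∀
  distribʳ₁ : ∀ a b c d e f →
    (c ℤ.+ e) ℤ.* b ℤ.+ (d ℤ.+ f) ℤ.* a ≡ (c ℤ.* b ℤ.+ d ℤ.* a) ℤ.+ (e ℤ.* b ℤ.+ f ℤ.* a)
  distribʳ₁ = solve-∀
  *-comm₁ : ∀ a b c d → a ℤ.* d ℤ.+ b ℤ.* c ≡ c ℤ.* b ℤ.+ d ℤ.* a
  *-comm₁ = solve-∀

dual-commutativeRing : CommutativeRing 0ℓ 0ℓ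
dual-commutativeRing = record { isCommutativeRing = dual-isCommutativeRing }

open CommutativeRing dual-commutativeRing
  using () renaming (*-identityˡ to *ᴰ-identityˡ; *-identityʳ to *ᴰ-identityʳ; *-comm to *ᴰ-comm)

-- Recognising 0ᴰ lets the ring solver drop terms with coefficient ε · ε = 0ᴰ.
is-0ᴰ : (x : Dual) → Maybe (0ᴰ ≡ x)
is-0ᴰ (dual a b) with a ℤ.≟ + 0 | b ℤ.≟ + 0
... | yes refl | yes refl = just refl
... | _ | _ = nothing

module DualSolver = RingSolver (ACR.fromCommutativeRing dual-commutativeRing is-0ᴰ)

open Determinant dual-commutativeRing id
  using (Matrix; sgn; minor; det-cong; det-pendant-last; det-isolated-last)
  renaming (det to detᴰ)
open import Algebra.Properties.Semiring.Sum (CommutativeRing.semiring dual-commutativeRing) using (sum; sum-cong-≗)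

coeff₀ : Poly → ℤ
coeff₀ [] = + 0
coeff₀ (a ∷ _) = a

-- The image of a polynomial in ℤ[λ]/(λ²), with λ ↦ ε.
jet : Poly → Dual
jet p = dual (coeff₀ p) (coeff₀ (drop 1 p))

⊕-identityʳ : ∀ p → p ⊕ [] ≡ p
⊕-identityʳ [] = refl
⊕-identityʳ (a ∷ p) = refl

coeff₀-⊕ : ∀ p q → coeff₀ (p ⊕ q) ≡ coeff₀ p ℤ.+ coeff₀ q
coeff₀-⊕ [] q = sym (ℤP.+-identityˡ _)
coeff₀-⊕ (a ∷ p) [] = sym (ℤP.+-identityʳ a)
coeff₀-⊕ (a ∷ p) (b ∷ q) = refl

drop₁-⊕ : ∀ p q → drop 1 (p ⊕ q) ≡ drop 1 p ⊕ drop 1 q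
drop₁-⊕ [] q = refl
drop₁-⊕ (a ∷ p) [] = sym (⊕-identityʳ p)
drop₁-⊕ (a ∷ p) (b ∷ q) = refl

jet-⊕ : ∀ p q → jet (p ⊕ q) ≡ jet p +ᴰ jet q
jet-⊕ p q = cong₂ dual (coeff₀-⊕ p q) (trans (cong coeff₀ (drop₁-⊕ p q)) (coeff₀-⊕ (drop 1 p) (drop 1 q)))

coeff₀-scale : ∀ c p → coeff₀ (scale c p) ≡ c ℤ.* coeff₀ p
coeff₀-scale c [] = sym (ℤP.*-zeroʳ c)
coeff₀-scale c (a ∷ p) = refl

drop₁-scale : ∀ c p → drop 1 (scale c p) ≡ scale c (drop 1 p)
drop₁-scale c [] = refl
drop₁-scale c (a ∷ p) = refl

jet-scale : ∀ c p → jet (scale c p) ≡ dual c (+ 0) *ᴰ jet p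
jet-scale c p = cong₂ dual (coeff₀-scale c p) (begin
    coeff₀ (drop 1 (scale c p))            ≡⟨ cong coeff₀ (drop₁-scale c p) ⟩
    coeff₀ (scale c (drop 1 p))            ≡⟨ coeff₀-scale c (drop 1 p) ⟩
    c ℤ.* coeff₀ (drop 1 p)                ≡⟨ ℤP.+-identityʳ _ ⟨
    c ℤ.* coeff₀ (drop 1 p) ℤ.+ + 0        ≡⟨ cong (λ x → c ℤ.* coeff₀ (drop 1 p) ℤ.+ x) (ℤP.*-zeroˡ (coeff₀ p)) ⟨
    c ℤ.* coeff₀ (drop 1 p) ℤ.+ + 0 ℤ.* coeff₀ p  ∎)
  where open ≡-Reasoning

coeff₀-⊛ : ∀ p q → coeff₀ (p ⊛ q) ≡ coeff₀ p ℤ.* coeff₀ q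
coeff₀-⊛ [] q = refl
coeff₀-⊛ (a ∷ p) q = trans (coeff₀-⊕ (scale a q) (+ 0 ∷ (p ⊛ q))) (trans (ℤP.+-identityʳ _) (coeff₀-scale a q))

coeff₁-⊛ : ∀ p q → coeff₀ (drop 1 (p ⊛ q)) ≡ coeff₀ p ℤ.* coeff₀ (drop 1 q) ℤ.+ coeff₀ (drop 1 p) ℤ.* coeff₀ q
coeff₁-⊛ [] q = refl
coeff₁-⊛ (a ∷ p) q = begin
    coeff₀ (drop 1 (scale a q ⊕ (+ 0 ∷ (p ⊛ q))))
  ≡⟨ cong coeff₀ (drop₁-⊕ (scale a q) (+ 0 ∷ (p ⊛ q))) ⟩
    coeff₀ (drop 1 (scale a q) ⊕ (p ⊛ q))
  ≡⟨ coeff₀-⊕ (drop 1 (scale a q)) (p ⊛ q) ⟩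
    coeff₀ (drop 1 (scale a q)) ℤ.+ coeff₀ (p ⊛ q)
  ≡⟨ cong₂ ℤ._+_ (trans (cong coeff₀ (drop₁-scale a q)) (coeff₀-scale a (drop 1 q))) (coeff₀-⊛ p q) ⟩
    a ℤ.* coeff₀ (drop 1 q) ℤ.+ coeff₀ p ℤ.* coeff₀ q
  ∎
  where open ≡-Reasoning

jet-⊛ : ∀ p q → jet (p ⊛ q) ≡ jet p *ᴰ jet q
jet-⊛ p q = cong₂ dual (coeff₀-⊛ p q) (coeff₁-⊛ p q)

jet-sumFin : ∀ {n} (f : Fin n → Poly) → jet (sumFin f) ≡ sum (jet ∘ f)
jet-sumFin {zero} f = refl
jet-sumFin {suc n} f = trans (jet-⊕ (f zero) (sumFin (f ∘ suc))) (cong (jet (f zero) +ᴰ_) (jet-sumFin (f ∘ suc)))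

jet-sign : ∀ k → dual (sign k) (+ 0) ≡ sgn k
jet-sign zero = refl
jet-sign (suc k) = cong (λ x → -ᴰ x) (jet-sign k)

jet-det : ∀ n (M : Fin n → Fin n → Poly) → jet (det n M) ≡ detᴰ n (λ i j → jet (M i j))
jet-det zero M = refl
jet-det (suc n) M = trans (jet-sumFin λ j → scale (sign (toℕ j)) (M zero j ⊛ det n (minorₚ j)))
  (sum-cong-≗ λ j → begin
    jet (scale (sign (toℕ j)) (M zero j ⊛ det n (minorₚ j)))
  ≡⟨ jet-scale (sign (toℕ j)) (M zero j ⊛ det n (minorₚ j)) ⟩
    dual (sign (toℕ j)) (+ 0) *ᴰ jet (M zero j ⊛ det n (minorₚ j))
  ≡⟨ cong₂ _*ᴰ_ (jet-sign (toℕ j))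
      (trans (jet-⊛ (M zero j) (det n (minorₚ j))) (cong (jet (M zero j) *ᴰ_) (jet-det n (minorₚ j)))) ⟩
    sgn (toℕ j) *ᴰ (jet (M zero j) *ᴰ detᴰ n (minor (λ i k → jet (M i k)) zero j))
  ∎)
  where
  open ≡-Reasoning
  minorₚ : Fin (suc n) → Fin n → Fin n → Poly
  minorₚ j k l = M (suc k) (punchIn j l)

lowestTerm-degree₀ : ∀ p {a} → a ≢ + 0 → c₀ (jet p) ≡ a → lowestTerm p ≡ just (a , 0)
lowestTerm-degree₀ [] a≢0 refl = ⊥-elim (a≢0 refl)
lowestTerm-degree₀ (+ zero ∷ p) a≢0 refl = ⊥-elim (a≢0 refl)
lowestTerm-degree₀ (+ suc k ∷ p) _ refl = refl
lowestTerm-degree₀ (-[1+ k ] ∷ p) _ refl = refl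

lowestTerm-degree₁ : ∀ p {b} → b ≢ + 0 → c₀ (jet p) ≡ + 0 → c₁ (jet p) ≡ b → lowestTerm p ≡ just (b , 1)
lowestTerm-degree₁ [] b≢0 _ refl = ⊥-elim (b≢0 refl)
lowestTerm-degree₁ (+ zero ∷ []) b≢0 _ refl = ⊥-elim (b≢0 refl)
lowestTerm-degree₁ (+ zero ∷ + zero ∷ p) b≢0 _ refl = ⊥-elim (b≢0 refl)
lowestTerm-degree₁ (+ zero ∷ + suc k ∷ p) _ _ refl = refl
lowestTerm-degree₁ (+ zero ∷ -[1+ k ] ∷ p) _ _ refl = refl
lowestTerm-degree₁ (+ suc k ∷ p) _ () _
lowestTerm-degree₁ (-[1+ k ] ∷ p) _ () _

pathJet : ℕ → Dual
pathJet zero = 1ᴰ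
pathJet (suc zero) = ε
pathJet (suc (suc k)) = ε *ᴰ pathJet (suc k) -ᴰ pathJet k

record PathJetPeriod (q : ℕ) : Set where
  field
    at-4q   : pathJet (q * 4) ≡ dual (+ 1) (+ 0)
    at-4q+1 : pathJet (1 + q * 4) ≡ dual (+ 0) (+ (1 + q * 2))
    at-4q+2 : pathJet (2 + q * 4) ≡ dual -[1+ 0 ] (+ 0)
    at-4q+3 : pathJet (3 + q * 4) ≡ dual (+ 0) (ℤ.- (+ (2 + q * 2)))

pathJet-period : ∀ q → PathJetPeriod q
pathJet-period zero = record { at-4q = refl ; at-4q+1 = refl ; at-4q+2 = refl ; at-4q+3 = refl }
pathJet-period (suc q) = record { at-4q = at-4q+4 ; at-4q+1 = at-4q+5 ; at-4q+2 = at-4q+6 ; at-4q+3 = at-4q+7 }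
  where
  open PathJetPeriod (pathJet-period q)
  step : Dual → Dual → Dual
  step x y = ε *ᴰ x -ᴰ y
  step-dual : ∀ a b c d → step (dual a b) (dual c d) ≡ dual (ℤ.- c) (a ℤ.- d)
  step-dual a b c d = cong₂ dual (ℤP.+-identityˡ (ℤ.- c))
    (cong (ℤ._+ ℤ.- d) (trans (cong (ℤ._+ + 1 ℤ.* a) (ℤP.*-zeroˡ b)) (trans (ℤP.+-identityˡ _) (ℤP.*-identityˡ a))))
  at-4q+4 : pathJet (4 + q * 4) ≡ dual (+ 1) (+ 0)
  at-4q+4 = trans (cong₂ step at-4q+3 at-4q+2) (step-dual (+ 0) (ℤ.- (+ (2 + q * 2))) -[1+ 0 ] (+ 0))
  at-4q+5 : pathJet (5 + q * 4) ≡ dual (+ 0) (+ (3 + q * 2))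
  at-4q+5 = trans (cong₂ step at-4q+4 at-4q+3) (trans (step-dual (+ 1) (+ 0) (+ 0) (ℤ.- (+ (2 + q * 2))))
                (cong (λ z → dual (+ 0) (+ 1 ℤ.+ z)) (ℤP.neg-involutive (+ (2 + q * 2)))))
  at-4q+6 : pathJet (6 + q * 4) ≡ dual -[1+ 0 ] (+ 0)
  at-4q+6 = trans (cong₂ step at-4q+5 at-4q+4) (step-dual (+ 0) (+ (3 + q * 2)) (+ 1) (+ 0))
  at-4q+7 : pathJet (7 + q * 4) ≡ dual (+ 0) (ℤ.- (+ (4 + q * 2)))
  at-4q+7 = trans (cong₂ step at-4q+6 at-4q+5) (step-dual -[1+ 0 ] (+ 0) (+ 0) (+ (3 + q * 2)))

-- Characteristic polynomials modulo λ²

T⇔T⇒≡ : ∀ {x y} → T x ⇔ T y → x ≡ y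
T⇔T⇒≡ {false} {false} _ = refl
T⇔T⇒≡ {false} {true} x⇔y = ⊥-elim (Equivalence.from x⇔y _)
T⇔T⇒≡ {true} {false} x⇔y = ⊥-elim (Equivalence.to x⇔y _)
T⇔T⇒≡ {true} {true} _ = refl

≡ᵇ-cong : ∀ {m n m′ n′} → (m ≡ n → m′ ≡ n′) → (m′ ≡ n′ → m ≡ n) → (m ≡ᵇ n) ≡ (m′ ≡ᵇ n′)
≡ᵇ-cong {m} {n} {m′} {n′} to from =
  T⇔T⇒≡ (mk⇔ (ℕP.≡⇒≡ᵇ m′ n′ ∘ to ∘ ℕP.≡ᵇ⇒≡ m n) (ℕP.≡⇒≡ᵇ m n ∘ from ∘ ℕP.≡ᵇ⇒≡ m′ n′))

≡ᵇ-≢ : ∀ {m n} → m ≢ n → (m ≡ᵇ n) ≡ false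
≡ᵇ-≢ {m} {n} m≢n = ≡ᵇ-cong {m} {n} {0} {1} (⊥-elim ∘ m≢n) λ ()

≡ᵇ-refl : ∀ n → (n ≡ᵇ n) ≡ true
≡ᵇ-refl zero = refl
≡ᵇ-refl (suc n) = ≡ᵇ-refl n

toℕ<n-of-≢fromℕ : ∀ {n} (i : Fin (suc n)) → i ≢ fromℕ n → toℕ i < n
toℕ<n-of-≢fromℕ {n} i i≢n = ℕP.≤∧≢⇒< (subst (toℕ i ≤_) (toℕ-fromℕ n) (≤fromℕ i))
  λ eq → i≢n (toℕ-injective (trans eq (sym (toℕ-fromℕ n))))

-- punchInℕ u enumerates ℕ ∖ {u}, mirroring punchIn on Fin.
punchInℕ : ℕ → ℕ → ℕ
punchInℕ zero x = suc x
punchInℕ (suc u) zero = zero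
punchInℕ (suc u) (suc x) = suc (punchInℕ u x)

toℕ-punchIn : ∀ {n} (u : Fin (suc n)) (i : Fin n) → toℕ (punchIn u i) ≡ punchInℕ (toℕ u) (toℕ i)
toℕ-punchIn zero i = refl
toℕ-punchIn (suc u) zero = refl
toℕ-punchIn (suc u) (suc i) = cong suc (toℕ-punchIn u i)

toℕ-punchIn-fromℕ : ∀ {n} (i : Fin n) → toℕ (punchIn (fromℕ n) i) ≡ toℕ i
toℕ-punchIn-fromℕ i = trans (cong toℕ (punchIn-fromℕ i)) (toℕ-inject₁ i)

punchInℕ-< : ∀ {u x} → x < u → punchInℕ u x ≡ x
punchInℕ-< {suc u} {zero} _ = refl
punchInℕ-< {suc u} {suc x} (s≤s x<u) = cong suc (punchInℕ-< x<u)

punchInℕ-≥ : ∀ {u x} → u ≤ x → punchInℕ u x ≡ suc x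
punchInℕ-≥ {zero} _ = refl
punchInℕ-≥ {suc u} {suc x} (s≤s u≤x) = cong suc (punchInℕ-≥ u≤x)

punchInℕ-≤ : ∀ u x → punchInℕ u x ≤ suc x
punchInℕ-≤ zero x = ℕP.≤-refl
punchInℕ-≤ (suc u) zero = z≤n
punchInℕ-≤ (suc u) (suc x) = s≤s (punchInℕ-≤ u x)

entryᴰ : Bool → Bool → Dual
entryᴰ diagonal adjacent = (if diagonal then ε else 0ᴰ) +ᴰ (if adjacent then -ᴰ 1ᴰ else 0ᴰ)

jet-charMatrix : ∀ (G : Graph) i j →
  jet (charMatrix G i j) ≡ entryᴰ (toℕ i ≡ᵇ toℕ j) (adjacent G (toℕ i) (toℕ j))
jet-charMatrix G i j with toℕ i ≡ᵇ toℕ j | adjacent G (toℕ i) (toℕ j)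
... | true  | true  = refl
... | true  | false = refl
... | false | true  = refl
... | false | false = refl

-- λI − A modulo λ² on the vertices g 0, …, g (n − 1) of the graph with adjacency adj.
charMatrixᴰ : (ℕ → ℕ → Bool) → (ℕ → ℕ) → ∀ n → Matrix n
charMatrixᴰ adj g n i j = entryᴰ (toℕ i ≡ᵇ toℕ j) (adj (g (toℕ i)) (g (toℕ j)))

jet-charPoly : ∀ G adj → (∀ x y → adjacent G x y ≡ adj x y) →
  jet (charPoly G) ≡ detᴰ (order G) (charMatrixᴰ adj id (order G))
jet-charPoly G adj same = trans (jet-det (order G) (charMatrix G))
  (det-cong (order G) λ i j → trans (jet-charMatrix G i j) (cong (entryᴰ (toℕ i ≡ᵇ toℕ j)) (same (toℕ i) (toℕ j))))

module CharacteristicJet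
  (adj : ℕ → ℕ → Bool) (adj-sym : ∀ x y → adj x y ≡ adj y x) (adj-irrefl : ∀ x → adj x x ≡ false)
  where

  -- Opaque because unfolding a determinant of size 10 + t during conversion checking blows up.
  opaque
    charJet : (ℕ → ℕ) → ℕ → Dual
    charJet g n = detᴰ n (charMatrixᴰ adj g n)

    charJet-unfold : ∀ g n → charJet g n ≡ detᴰ n (charMatrixᴰ adj g n)
    charJet-unfold g n = refl

  charJet-empty : ∀ g → charJet g 0 ≡ 1ᴰ
  charJet-empty g = charJet-unfold g 0

  charJet-cong : ∀ n {g h} → (∀ x → x < n → g x ≡ h x) → charJet g n ≡ charJet h n
  charJet-cong n {g} {h} g≗h = trans (charJet-unfold g n) (trans (det-cong n λ i j →
      cong₂ (λ x y → entryᴰ (toℕ i ≡ᵇ toℕ j) (adj x y)) (g≗h (toℕ i) (toℕ<n i)) (g≗h (toℕ j) (toℕ<n j)))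
    (sym (charJet-unfold h n)))

  charMatrix-reindex : ∀ {a b} g (f : Fin a → Fin b) (h : ℕ → ℕ) →
    (∀ i → toℕ (f i) ≡ h (toℕ i)) → (∀ i j → f i ≡ f j → i ≡ j) →
    ∀ i j → charMatrixᴰ adj g b (f i) (f j) ≡ charMatrixᴰ adj (g ∘ h) a i j
  charMatrix-reindex g f h toℕ-f f-injective i j = cong₂ entryᴰ
    (≡ᵇ-cong (λ eq → cong toℕ (f-injective i j (toℕ-injective eq))) (cong (toℕ ∘ f) ∘ toℕ-injective))
    (cong₂ (λ x y → adj (g x) (g y)) (toℕ-f i) (toℕ-f j))

  charJet-delete-last : ∀ g m →
    detᴰ m (minor (charMatrixᴰ adj g (suc m)) (fromℕ m) (fromℕ m)) ≡ charJet g m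
  charJet-delete-last g m = trans (det-cong m (charMatrix-reindex g (punchIn (fromℕ m)) id toℕ-punchIn-fromℕ
    (λ i j → punchIn-injective (fromℕ m) i j))) (sym (charJet-unfold g m))

  charMatrix-last-diagonal : ∀ g m → charMatrixᴰ adj g (suc m) (fromℕ m) (fromℕ m) ≡ ε
  charMatrix-last-diagonal g m = cong₂ entryᴰ
    (trans (cong (λ x → x ≡ᵇ x) (toℕ-fromℕ m)) (≡ᵇ-refl m))
    (trans (cong (λ x → adj (g x) (g x)) (toℕ-fromℕ m)) (adj-irrefl (g m)))

  charMatrix-last-row : ∀ g m j → j ≢ fromℕ m →
    charMatrixᴰ adj g (suc m) (fromℕ m) j ≡ entryᴰ false (adj (g m) (g (toℕ j)))
  charMatrix-last-row g m j j≢L = cong₂ entryᴰ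
    (trans (cong (_≡ᵇ toℕ j) (toℕ-fromℕ m)) (≡ᵇ-≢ λ eq → j≢L (toℕ-injective (trans (sym eq) (sym (toℕ-fromℕ m))))))
    (cong (λ x → adj (g x) (g (toℕ j))) (toℕ-fromℕ m))

  charMatrix-last-col : ∀ g m i → i ≢ fromℕ m →
    charMatrixᴰ adj g (suc m) i (fromℕ m) ≡ entryᴰ false (adj (g m) (g (toℕ i)))
  charMatrix-last-col g m i i≢L = cong₂ entryᴰ
    (trans (cong (toℕ i ≡ᵇ_) (toℕ-fromℕ m)) (≡ᵇ-≢ λ eq → i≢L (toℕ-injective (trans eq (sym (toℕ-fromℕ m))))))
    (trans (cong (λ x → adj (g (toℕ i)) (g x)) (toℕ-fromℕ m)) (adj-sym _ _))

  charJet-isolated : ∀ g m → (∀ x → x < m → adj (g m) (g x) ≡ false) → charJet g (suc m) ≡ ε *ᴰ charJet g m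
  charJet-isolated g m no-edge = begin
    charJet g (suc m)                     ≡⟨ charJet-unfold g (suc m) ⟩
    detᴰ (suc m) M                        ≡⟨ det-isolated-last m M row≡0 ⟩
    M L L *ᴰ detᴰ m (minor M L L)         ≡⟨ cong₂ _*ᴰ_ (charMatrix-last-diagonal g m) (charJet-delete-last g m) ⟩
    ε *ᴰ charJet g m                      ∎
    where
    open ≡-Reasoning
    M = charMatrixᴰ adj g (suc m)
    L = fromℕ m
    row≡0 : ∀ j → j ≢ L → M L j ≡ 0ᴰ
    row≡0 j j≢L = trans (charMatrix-last-row g m j j≢L)
      (cong (entryᴰ false) (no-edge (toℕ j) (toℕ<n-of-≢fromℕ j j≢L)))

  charJet-pendant : ∀ g m w → w < suc m →
    adj (g (suc m)) (g w) ≡ true →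
    (∀ x → x < suc m → x ≢ w → adj (g (suc m)) (g x) ≡ false) →
    charJet g (suc (suc m)) ≡ ε *ᴰ charJet g (suc m) -ᴰ charJet (g ∘ punchInℕ w) m
  charJet-pendant g m w w<1+m edge no-edge = begin
    charJet g (suc (suc m))
      ≡⟨ charJet-unfold g (suc (suc m)) ⟩
    detᴰ (suc (suc m)) M
      ≡⟨ det-pendant-last m M u (λ j j≢L j≢u → trans (charMatrix-last-row g (suc m) j j≢L) (no-edge′ j j≢L j≢u))
                                (λ i i≢L i≢u → trans (charMatrix-last-col g (suc m) i i≢L) (no-edge′ i i≢L i≢u)) ⟩
    M L L *ᴰ detᴰ (suc m) (minor M L L) -ᴰ M L (inject₁ u) *ᴰ M (inject₁ u) L *ᴰ detᴰ m (minor (minor M L L) u u)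
      ≡⟨ cong₂ _-ᴰ_ (cong₂ _*ᴰ_ (charMatrix-last-diagonal g (suc m)) (charJet-delete-last g (suc m)))
                    (cong₂ (λ a b → a *ᴰ b *ᴰ detᴰ m (minor (minor M L L) u u)) neighbour-row neighbour-col) ⟩
    ε *ᴰ charJet g (suc m) -ᴰ 1ᴰ *ᴰ detᴰ m (minor (minor M L L) u u)
      ≡⟨ cong (λ x → ε *ᴰ charJet g (suc m) -ᴰ x) (trans (*ᴰ-identityˡ _) delete-both) ⟩
    ε *ᴰ charJet g (suc m) -ᴰ charJet (g ∘ punchInℕ w) m
      ∎
    where
    open ≡-Reasoning
    M = charMatrixᴰ adj g (suc (suc m))
    L = fromℕ (suc m)
    u = fromℕ< w<1+m
    toℕ-inject₁-u : toℕ (inject₁ u) ≡ w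
    toℕ-inject₁-u = trans (toℕ-inject₁ u) (toℕ-fromℕ< w<1+m)
    inject₁-u≢L : inject₁ u ≢ L
    inject₁-u≢L eq = ℕP.<-irrefl (trans (sym toℕ-inject₁-u) (trans (cong toℕ eq) (toℕ-fromℕ (suc m)))) w<1+m
    no-edge′ : ∀ j → j ≢ L → j ≢ inject₁ u → entryᴰ false (adj (g (suc m)) (g (toℕ j))) ≡ 0ᴰ
    no-edge′ j j≢L j≢u = cong (entryᴰ false) (no-edge (toℕ j) (toℕ<n-of-≢fromℕ j j≢L)
      λ eq → j≢u (toℕ-injective (trans eq (sym toℕ-inject₁-u))))
    neighbour-row : M L (inject₁ u) ≡ -ᴰ 1ᴰ
    neighbour-row = trans (charMatrix-last-row g (suc m) (inject₁ u) inject₁-u≢L)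
      (cong (entryᴰ false) (trans (cong (adj (g (suc m)) ∘ g) toℕ-inject₁-u) edge))
    neighbour-col : M (inject₁ u) L ≡ -ᴰ 1ᴰ
    neighbour-col = trans (charMatrix-last-col g (suc m) (inject₁ u) inject₁-u≢L)
      (cong (entryᴰ false) (trans (cong (adj (g (suc m)) ∘ g) toℕ-inject₁-u) edge))
    delete-both : detᴰ m (minor (minor M L L) u u) ≡ charJet (g ∘ punchInℕ w) m
    delete-both = trans
      (det-cong m (charMatrix-reindex g (λ i → punchIn L (punchIn u i)) (punchInℕ w)
        (λ i → trans (toℕ-punchIn-fromℕ (punchIn u i))
                 (trans (toℕ-punchIn u i) (cong (λ v → punchInℕ v (toℕ i)) (toℕ-fromℕ< w<1+m))))
        (λ i j eq → punchIn-injective u i j (punchIn-injective L (punchIn u i) (punchIn u j) eq))))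
      (sym (charJet-unfold (g ∘ punchInℕ w) m))

  -- Positions p, …, p + K − 1 carry an induced path that is joined to no earlier position.
  charJet-path : ∀ g p K →
    (∀ y → p ≤ y → suc y < K + p → adj (g (suc y)) (g y) ≡ true) →
    (∀ x y → p ≤ x → x < K + p → y < x → ¬ (suc y ≡ x × p ≤ y) → adj (g x) (g y) ≡ false) →
    ∀ k → k ≤ K → charJet g (k + p) ≡ charJet g p *ᴰ pathJet k
  charJet-path g p K edge no-edge zero _ = sym (*ᴰ-identityʳ _)
  charJet-path g p K edge no-edge (suc zero) 1≤K =
    trans (charJet-isolated g p λ y y<p → no-edge p y ℕP.≤-refl (ℕP.+-monoˡ-≤ p 1≤K) y<p
                                             λ { (_ , p≤y) → ℕP.<⇒≱ y<p p≤y })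
          (*ᴰ-comm ε (charJet g p))
  charJet-path g p K edge no-edge (suc (suc k)) 2+k≤K = begin
      charJet g (suc (suc k) + p)
    ≡⟨ charJet-pendant g (k + p) (k + p) (ℕP.n<1+n _) (edge (k + p) p≤k+p 1+k+p<K+p)
         (λ x x<1+k+p x≢k+p → no-edge (suc (k + p)) x (ℕP.m≤n⇒m≤1+n p≤k+p) 1+k+p<K+p x<1+k+p
           λ { (eq , _) → x≢k+p (ℕP.suc-injective eq) }) ⟩
      ε *ᴰ charJet g (suc k + p) -ᴰ charJet (g ∘ punchInℕ (k + p)) (k + p)
    ≡⟨ cong (λ x → ε *ᴰ charJet g (suc k + p) -ᴰ x) (charJet-cong (k + p) λ x x< → cong g (punchInℕ-< x<)) ⟩
      ε *ᴰ charJet g (suc k + p) -ᴰ charJet g (k + p)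
    ≡⟨ cong₂ (λ a b → ε *ᴰ a -ᴰ b) (charJet-path g p K edge no-edge (suc k) (ℕP.<⇒≤ 2+k≤K))
                                    (charJet-path g p K edge no-edge k (ℕP.≤-trans (ℕP.n≤1+n k) (ℕP.<⇒≤ 2+k≤K))) ⟩
      ε *ᴰ (charJet g p *ᴰ pathJet (suc k)) -ᴰ charJet g p *ᴰ pathJet k
    ≡⟨ factor ε (charJet g p) (pathJet (suc k)) (pathJet k) ⟩
      charJet g p *ᴰ pathJet (suc (suc k))
    ∎
    where
    open ≡-Reasoning
    open DualSolver using (solve; _⊜_; _⊗_; ⊝_) renaming (_⊕_ to _⊞_)
    p≤k+p : p ≤ k + p
    p≤k+p = ℕP.m≤n+m p k
    1+k+p<K+p : suc (k + p) < K + p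
    1+k+p<K+p = ℕP.+-monoˡ-≤ p 2+k≤K
    factor : ∀ e d x y → e *ᴰ (d *ᴰ x) -ᴰ d *ᴰ y ≡ d *ᴰ (e *ᴰ x -ᴰ y)
    factor = solve 4 (λ e d x y → (e ⊗ (d ⊗ x) ⊞ ⊝ (d ⊗ y)) ⊜ (d ⊗ (e ⊗ x ⊞ ⊝ y))) refl

-- The tree H (10 + t)

adjacent⇔∈ : ∀ G x y → T (adjacent G x y) ⇔ ((x , y) ∈ edges G ⊎ (y , x) ∈ edges G)
adjacent⇔∈ G x y = mk⇔
  (Any-⊎⁻ ∘ Any.map (λ {(a , b)} → joins a b) ∘ any⁻ _ (edges G))
  (any⁺ _ ∘ Any.map (λ {(a , b)} → joined a b) ∘ Any-⊎⁺)
  where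
  joins : ∀ a b → T (((a ℕ.≡ᵇ x) ∧ (b ℕ.≡ᵇ y)) ∨ ((a ℕ.≡ᵇ y) ∧ (b ℕ.≡ᵇ x))) →
    (x , y) ≡ (a , b) ⊎ (y , x) ≡ (a , b)
  joins a b h with Equivalence.to T-∨ h
  ... | inj₁ h′ = let (p , q) = Equivalence.to T-∧ h′ in
    inj₁ (sym (cong₂ _,_ (ℕP.≡ᵇ⇒≡ a x p) (ℕP.≡ᵇ⇒≡ b y q)))
  ... | inj₂ h′ = let (p , q) = Equivalence.to T-∧ h′ in
    inj₂ (sym (cong₂ _,_ (ℕP.≡ᵇ⇒≡ a y p) (ℕP.≡ᵇ⇒≡ b x q)))
  joined : ∀ a b → (x , y) ≡ (a , b) ⊎ (y , x) ≡ (a , b) →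
    T (((a ℕ.≡ᵇ x) ∧ (b ℕ.≡ᵇ y)) ∨ ((a ℕ.≡ᵇ y) ∧ (b ℕ.≡ᵇ x)))
  joined a b (inj₁ refl) =
    Equivalence.from T-∨ (inj₁ (Equivalence.from T-∧ (ℕP.≡⇒≡ᵇ x x refl , ℕP.≡⇒≡ᵇ y y refl)))
  joined a b (inj₂ refl) =
    Equivalence.from T-∨ (inj₂ (Equivalence.from T-∧ (ℕP.≡⇒≡ᵇ y y refl , ℕP.≡⇒≡ᵇ x x refl)))

-- H (10 + t) has the spine 0, …, 5 + t, the pendant path 6 + t, 7 + t at 2 and 8 + t, 9 + t at 3 + t.
data Edge (t : ℕ) : ℕ → ℕ → Set where
  spine    : ∀ k → k < 5 + t → Edge t k (suc k)
  attach₁  : Edge t 2 (6 + t)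
  pendant₁ : Edge t (6 + t) (7 + t)
  attach₂  : Edge t (3 + t) (8 + t)
  pendant₂ : Edge t (8 + t) (9 + t)

Adjacent : ℕ → ℕ → ℕ → Set
Adjacent t x y = Edge t x y ⊎ Edge t y x

Edge⇔∈ : ∀ {t a b} → Edge t a b ⇔ ((a , b) ∈ edges (H (10 + t)))
Edge⇔∈ {t} = mk⇔ to from
  where
  L₁ = pathEdges 0 (6 + t)
  L₂ = pendantEdges 2 (6 + t) 2
  L₃ = pendantEdges (3 + t) (6 + t + 2) 2
  6+t+0≡6+t : 6 + t + 0 ≡ 6 + t
  6+t+0≡6+t = ℕP.+-identityʳ (6 + t)
  8+t+0≡8+t : 6 + t + 2 + 0 ≡ 8 + t
  8+t+0≡8+t = trans (ℕP.+-identityʳ _) (ℕP.+-comm (6 + t) 2)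
  8+t+1≡9+t : 6 + t + 2 + 1 ≡ 9 + t
  8+t+1≡9+t = trans (ℕP.+-comm (6 + t + 2) 1) (cong suc (ℕP.+-comm (6 + t) 2))
  in-L₂ : ∀ {e} → e ∈ L₂ → e ∈ edges (H (10 + t))
  in-L₂ = ∈-++⁺ʳ L₁ ∘ ∈-++⁺ˡ
  in-L₃ : ∀ {e} → e ∈ L₃ → e ∈ edges (H (10 + t))
  in-L₃ = ∈-++⁺ʳ L₁ ∘ ∈-++⁺ʳ L₂
  to : ∀ {a b} → Edge t a b → (a , b) ∈ edges (H (10 + t))
  to (spine k k<5+t) = ∈-++⁺ˡ (∈-applyUpTo⁺ (λ k → (k , suc k)) k<5+t)
  to attach₁ = in-L₂ (here refl)
  to pendant₁ = in-L₂ (there (here (cong₂ _,_ (sym 6+t+0≡6+t) (sym (ℕP.+-comm (6 + t) 1)))))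
  to attach₂ = in-L₃ (here (cong (3 + t ,_) (sym (ℕP.+-comm (6 + t) 2))))
  to pendant₂ = in-L₃ (there (here (cong₂ _,_ (sym 8+t+0≡8+t) (sym 8+t+1≡9+t))))
  from : ∀ {a b} → (a , b) ∈ edges (H (10 + t)) → Edge t a b
  from ab∈ with ∈-++⁻ L₁ {L₂ ++ L₃} ab∈
  ... | inj₁ ab∈spine with ∈-applyUpTo⁻ (λ k → (k , suc k)) ab∈spine
  ...   | k , k<5+t , refl = spine k k<5+t
  from ab∈ | inj₂ ab∈pendants with ∈-++⁻ L₂ {L₃} ab∈pendants
  ... | inj₁ (here refl) = attach₁
  ... | inj₁ (there (here refl)) = subst₂ (Edge t) (sym 6+t+0≡6+t) (sym (ℕP.+-comm (6 + t) 1)) pendant₁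
  ... | inj₂ (here refl) = subst (Edge t (3 + t)) (sym (ℕP.+-comm (6 + t) 2)) attach₂
  ... | inj₂ (there (here refl)) = subst₂ (Edge t) (sym 8+t+0≡8+t) (sym 8+t+1≡9+t) pendant₂

adjH : ℕ → ℕ → ℕ → Bool
adjH t = adjacent (H (10 + t))

adjH⇔Adjacent : ∀ t x y → T (adjH t x y) ⇔ Adjacent t x y
adjH⇔Adjacent t x y = mk⇔
  (Sum.map (Equivalence.from Edge⇔∈) (Equivalence.from Edge⇔∈) ∘ Equivalence.to (adjacent⇔∈ (H (10 + t)) x y))
  (Equivalence.from (adjacent⇔∈ (H (10 + t)) x y) ∘ Sum.map (Equivalence.to Edge⇔∈) (Equivalence.to Edge⇔∈))

adjH-edge : ∀ t {x y} → Adjacent t x y → adjH t x y ≡ true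
adjH-edge t {x} {y} = Equivalence.to T-≡ ∘ Equivalence.from (adjH⇔Adjacent t x y)

adjH-no-edge : ∀ t {x y} → ¬ Adjacent t x y → adjH t x y ≡ false
adjH-no-edge t {x} {y} ¬adj with adjH t x y in eq
... | true  = ⊥-elim (¬adj (Equivalence.to (adjH⇔Adjacent t x y) (Equivalence.from T-≡ eq)))
... | false = refl

adjH-sym : ∀ t x y → adjH t x y ≡ adjH t y x
adjH-sym t x y with adjH t y x in eq
... | true  = adjH-edge t (Sum.swap (Equivalence.to (adjH⇔Adjacent t y x) (Equivalence.from T-≡ eq)))
... | false = adjH-no-edge t λ adj → subst T eq (Equivalence.from (adjH⇔Adjacent t y x) (Sum.swap adj))

adjH-irrefl : ∀ t x → adjH t x x ≡ false
adjH-irrefl t x = adjH-no-edge t {x} {x} λ { (inj₁ ()) ; (inj₂ ()) }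

private
  +ʳ-<⇒≱ : ∀ {a b t} → a + t < b + t → b ≤ a → ⊥
  +ʳ-<⇒≱ {t = t} a+t<b+t b≤a = ℕP.<⇒≱ a+t<b+t (ℕP.+-monoˡ-≤ t b≤a)

module _ {t : ℕ} where

  neighbour-of-9+t : ∀ {y} → Adjacent t (9 + t) y → y ≡ 8 + t
  neighbour-of-9+t (inj₁ (spine _ 9+t<5+t)) = ⊥-elim (+ʳ-<⇒≱ {9} {5} 9+t<5+t (ℕP.m≤m+n 5 4))
  neighbour-of-9+t (inj₂ (spine _ 8+t<5+t)) = ⊥-elim (+ʳ-<⇒≱ {8} {5} 8+t<5+t (ℕP.m≤m+n 5 3))
  neighbour-of-9+t (inj₂ pendant₂) = refl

  neighbours-of-8+t : ∀ {y} → Adjacent t (8 + t) y → y ≡ 3 + t ⊎ y ≡ 9 + t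
  neighbours-of-8+t (inj₁ (spine _ 8+t<5+t)) = ⊥-elim (+ʳ-<⇒≱ {8} {5} 8+t<5+t (ℕP.m≤m+n 5 3))
  neighbours-of-8+t (inj₂ (spine _ 7+t<5+t)) = ⊥-elim (+ʳ-<⇒≱ {7} {5} 7+t<5+t (ℕP.m≤m+n 5 2))
  neighbours-of-8+t (inj₁ pendant₂) = inj₂ refl
  neighbours-of-8+t (inj₂ attach₂) = inj₁ refl

  neighbour-of-7+t : ∀ {y} → Adjacent t (7 + t) y → y ≡ 6 + t
  neighbour-of-7+t (inj₁ (spine _ 7+t<5+t)) = ⊥-elim (+ʳ-<⇒≱ {7} {5} 7+t<5+t (ℕP.m≤m+n 5 2))
  neighbour-of-7+t (inj₂ (spine _ 6+t<5+t)) = ⊥-elim (+ʳ-<⇒≱ {6} {5} 6+t<5+t (ℕP.m≤m+n 5 1))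
  neighbour-of-7+t (inj₂ pendant₁) = refl

  neighbours-of-6+t : ∀ {y} → Adjacent t (6 + t) y → y ≡ 2 ⊎ y ≡ 7 + t
  neighbours-of-6+t (inj₁ (spine _ 6+t<5+t)) = ⊥-elim (+ʳ-<⇒≱ {6} {5} 6+t<5+t (ℕP.m≤m+n 5 1))
  neighbours-of-6+t (inj₂ (spine _ 5+t<5+t)) = ⊥-elim (ℕP.<-irrefl refl 5+t<5+t)
  neighbours-of-6+t (inj₁ pendant₁) = inj₂ refl
  neighbours-of-6+t (inj₂ attach₁) = inj₁ refl

  spine-neighbours : ∀ {x y} → x < 6 + t → y < 6 + t → Adjacent t x y → suc x ≡ y ⊎ suc y ≡ x
  spine-neighbours _ _ (inj₁ (spine k _)) = inj₁ refl
  spine-neighbours _ _ (inj₂ (spine k _)) = inj₂ refl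
  spine-neighbours _ y<6+t (inj₁ attach₁) = ⊥-elim (ℕP.<-irrefl refl y<6+t)
  spine-neighbours x<6+t _ (inj₂ attach₁) = ⊥-elim (ℕP.<-irrefl refl x<6+t)
  spine-neighbours x<6+t _ (inj₁ pendant₁) = ⊥-elim (ℕP.<-irrefl refl x<6+t)
  spine-neighbours _ y<6+t (inj₂ pendant₁) = ⊥-elim (ℕP.<-irrefl refl y<6+t)
  spine-neighbours _ y<6+t (inj₁ attach₂) = ⊥-elim (+ʳ-<⇒≱ {8} {6} y<6+t (ℕP.m≤m+n 6 2))
  spine-neighbours x<6+t _ (inj₂ attach₂) = ⊥-elim (+ʳ-<⇒≱ {8} {6} x<6+t (ℕP.m≤m+n 6 2))
  spine-neighbours x<6+t _ (inj₁ pendant₂) = ⊥-elim (+ʳ-<⇒≱ {8} {6} x<6+t (ℕP.m≤m+n 6 2))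
  spine-neighbours _ y<6+t (inj₂ pendant₂) = ⊥-elim (+ʳ-<⇒≱ {8} {6} y<6+t (ℕP.m≤m+n 6 2))

module _ (t : ℕ) where
  open CharacteristicJet (adjH t) (adjH-sym t) (adjH-irrefl t)

  -- Positions p, …, p + K − 1 go to consecutive spine vertices, earlier positions to spine
  -- vertices at least two below them.
  charJet-spine : ∀ g p K c →
    (∀ x → x < K + p → g x < 6 + t) →
    (∀ y → p ≤ y → y < K + p → g y ≡ y + c) →
    (∀ y → y < p → suc (suc (g y)) ≤ p + c) →
    ∀ k → k ≤ K → charJet g (k + p) ≡ charJet g p *ᴰ pathJet k
  charJet-spine g p K c on-spine shifted below = charJet-path g p K edge no-edge
    where
    edge : ∀ y → p ≤ y → suc y < K + p → adjH t (g (suc y)) (g y) ≡ true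
    edge y p≤y 1+y<K+p = subst₂ (λ a b → adjH t a b ≡ true)
      (sym (shifted (suc y) (ℕP.m≤n⇒m≤1+n p≤y) 1+y<K+p)) (sym (shifted y p≤y (ℕP.<-trans (ℕP.n<1+n y) 1+y<K+p)))
      (adjH-edge t (inj₂ (spine (y + c) (ℕP.≤-pred (subst (_< 6 + t) (shifted (suc y) (ℕP.m≤n⇒m≤1+n p≤y) 1+y<K+p)
                                                              (on-spine (suc y) 1+y<K+p))))))
    no-edge : ∀ x y → p ≤ x → x < K + p → y < x → ¬ (suc y ≡ x × p ≤ y) → adjH t (g x) (g y) ≡ false
    no-edge x y p≤x x<K+p y<x not-consecutive = adjH-no-edge t λ adj →
      case-neighbours (spine-neighbours (on-spine x x<K+p) (on-spine y y<K+p) adj) (p ℕP.≤? y)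
      where
      y<K+p = ℕP.<-trans y<x x<K+p
      gx≡x+c = shifted x p≤x x<K+p
      p+c≤gx : p + c ≤ g x
      p+c≤gx = subst (p + c ≤_) (sym gx≡x+c) (ℕP.+-monoˡ-≤ c p≤x)
      case-neighbours : suc (g x) ≡ g y ⊎ suc (g y) ≡ g x → Dec (p ≤ y) → ⊥
      case-neighbours (inj₁ eq) (yes p≤y) =
        ℕP.<-asym (subst (_< x + c) (trans (sym (shifted y p≤y y<K+p)) (sym eq)) (ℕP.+-monoˡ-< c y<x))
                  (subst (_< suc (g x)) gx≡x+c (ℕP.n<1+n (g x)))
      case-neighbours (inj₁ eq) (no p≰y) = ℕP.<-irrefl refl (ℕP.≤-trans (ℕP.m≤n+m (suc (g x)) 2)
        (ℕP.≤-trans (subst (λ z → suc (suc z) ≤ p + c) (sym eq) (below y (ℕP.≰⇒> p≰y))) p+c≤gx))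
      case-neighbours (inj₂ eq) (yes p≤y) =
        not-consecutive (ℕP.+-cancelʳ-≡ c (suc y) x (trans (cong suc (sym (shifted y p≤y y<K+p))) (trans eq gx≡x+c)) , p≤y)
      case-neighbours (inj₂ eq) (no p≰y) =
        ℕP.<-irrefl refl (ℕP.≤-trans (below y (ℕP.≰⇒> p≰y)) (subst (p + c ≤_) (sym eq) p+c≤gx))

  private
    without-3+t : ℕ → ℕ
    without-3+t = punchInℕ (3 + t)

    without-3+t-≥ : ∀ {x} → 3 + t ≤ x → without-3+t x ≡ suc x
    without-3+t-≥ = punchInℕ-≥

    without-3+t-≤ : ∀ x → without-3+t x ≤ suc x
    without-3+t-≤ = punchInℕ-≤ (3 + t)

    k+t≤m+t : ∀ {k m} → k ℕ.≤ m → k + t ≤ m + t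
    k+t≤m+t = ℕP.+-monoˡ-≤ t

    no-neighbour-but : ∀ {v w x} → (∀ {y} → Adjacent t v y → y ≡ w) → x ≢ w → adjH t v x ≡ false
    no-neighbour-but only-w x≢w = adjH-no-edge t (x≢w ∘ only-w)

  peel-9+t : charJet id (10 + t) ≡ ε *ᴰ charJet id (9 + t) -ᴰ charJet id (8 + t)
  peel-9+t = trans
    (charJet-pendant id (8 + t) (8 + t) (ℕP.n<1+n _) (adjH-edge t (inj₂ pendant₂))
      λ x _ x≢8+t → no-neighbour-but neighbour-of-9+t x≢8+t)
    (cong (λ x → ε *ᴰ charJet id (9 + t) -ᴰ x) (charJet-cong (8 + t) λ _ x< → punchInℕ-< x<))

  peel-8+t : charJet id (9 + t) ≡ ε *ᴰ charJet id (8 + t) -ᴰ charJet without-3+t (7 + t)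
  peel-8+t = charJet-pendant id (7 + t) (3 + t) (k+t≤m+t (ℕP.m≤m+n 4 4)) (adjH-edge t (inj₂ attach₂))
    λ x x<8+t x≢3+t → adjH-no-edge t λ adj → case neighbours-of-8+t adj of λ
      { (inj₁ x≡3+t) → x≢3+t x≡3+t
      ; (inj₂ refl) → +ʳ-<⇒≱ {9} {8} x<8+t (ℕP.n≤1+n 8) }

  peel-7+t : charJet id (8 + t) ≡ ε *ᴰ charJet id (7 + t) -ᴰ charJet id (6 + t)
  peel-7+t = trans
    (charJet-pendant id (6 + t) (6 + t) (ℕP.n<1+n _) (adjH-edge t (inj₂ pendant₁))
      λ x _ x≢6+t → no-neighbour-but neighbour-of-7+t x≢6+t)
    (cong (λ x → ε *ᴰ charJet id (7 + t) -ᴰ x) (charJet-cong (6 + t) λ _ x< → punchInℕ-< x<))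

  peel-6+t : charJet id (7 + t) ≡ ε *ᴰ charJet id (6 + t) -ᴰ charJet (punchInℕ 2) (5 + t)
  peel-6+t = charJet-pendant id (5 + t) 2 (s≤s (s≤s (s≤s z≤n))) (adjH-edge t (inj₂ attach₁))
    λ x x<6+t x≢2 → adjH-no-edge t λ adj → case neighbours-of-6+t adj of λ
      { (inj₁ x≡2) → x≢2 x≡2
      ; (inj₂ refl) → +ʳ-<⇒≱ {7} {6} x<6+t (ℕP.n≤1+n 6) }

  peel-7+t-without-3+t : charJet without-3+t (7 + t) ≡ ε *ᴰ charJet without-3+t (6 + t) -ᴰ charJet without-3+t (5 + t)
  peel-7+t-without-3+t = trans
    (charJet-pendant without-3+t (5 + t) (5 + t) (ℕP.n<1+n _)
      (subst₂ (λ a b → adjH t a b ≡ true)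
        (sym (without-3+t-≥ (k+t≤m+t (ℕP.m≤m+n 3 3)))) (sym (without-3+t-≥ (k+t≤m+t (ℕP.m≤m+n 3 2))))
        (adjH-edge t (inj₂ pendant₁)))
      λ x x<6+t x≢5+t → subst (λ a → adjH t a (without-3+t x) ≡ false) (sym (without-3+t-≥ (k+t≤m+t (ℕP.m≤m+n 3 3))))
        (adjH-no-edge t λ adj → ℕP.<-irrefl (neighbour-of-7+t adj)
          (ℕP.≤-<-trans (without-3+t-≤ x) (s≤s (ℕP.≤∧≢⇒< (ℕP.≤-pred x<6+t) x≢5+t)))))
    (cong (λ x → ε *ᴰ charJet without-3+t (6 + t) -ᴰ x) (charJet-cong (5 + t) λ _ x< → cong without-3+t (punchInℕ-< x<)))

  peel-6+t-without-3+t :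
    charJet without-3+t (6 + t) ≡ ε *ᴰ charJet without-3+t (5 + t) -ᴰ charJet (without-3+t ∘ punchInℕ 2) (4 + t)
  peel-6+t-without-3+t = charJet-pendant without-3+t (4 + t) 2 (s≤s (s≤s (s≤s z≤n)))
    (subst (λ a → adjH t a 2 ≡ true) (sym (without-3+t-≥ (k+t≤m+t (ℕP.m≤m+n 3 2)))) (adjH-edge t (inj₂ attach₁)))
    λ x x<5+t x≢2 → subst (λ a → adjH t a (without-3+t x) ≡ false) (sym (without-3+t-≥ (k+t≤m+t (ℕP.m≤m+n 3 2))))
      (adjH-no-edge t λ adj → case neighbours-of-6+t adj of λ
        { (inj₁ image≡2) → x≢2 (without-3+t≡2 x image≡2)
        ; (inj₂ image≡7+t) → +ʳ-<⇒≱ {7} {6}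
            (subst (_< 6 + t) image≡7+t (ℕP.≤-<-trans (without-3+t-≤ x) (s≤s x<5+t))) (ℕP.n≤1+n 6) })
    where
    without-3+t≡2 : ∀ x → without-3+t x ≡ 2 → x ≡ 2
    without-3+t≡2 2 _ = refl
    without-3+t≡2 (suc (suc (suc x))) ()

  spine-prefix : ∀ k → k ≤ 6 + t → charJet id k ≡ pathJet k
  spine-prefix k k≤6+t = begin
    charJet id k                      ≡⟨ cong (charJet id) (ℕP.+-identityʳ k) ⟨
    charJet id (k + 0)                ≡⟨ charJet-spine id 0 (6 + t) 0 on-spine shifted (λ _ ()) k k≤6+t ⟩
    charJet id 0 *ᴰ pathJet k         ≡⟨ cong (_*ᴰ pathJet k) (charJet-empty id) ⟩
    1ᴰ *ᴰ pathJet k                   ≡⟨ *ᴰ-identityˡ (pathJet k) ⟩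
    pathJet k                         ∎
    where
    open ≡-Reasoning
    on-spine : ∀ x → x < 6 + t + 0 → x < 6 + t
    on-spine x = subst (x <_) (ℕP.+-identityʳ (6 + t))
    shifted : ∀ y → 0 ≤ y → y < 6 + t + 0 → y ≡ y + 0
    shifted y _ _ = sym (ℕP.+-identityʳ y)

  spine-without-2 : charJet (punchInℕ 2) (5 + t) ≡ pathJet 2 *ᴰ pathJet (3 + t)
  spine-without-2 = begin
    charJet (punchInℕ 2) (5 + t)                   ≡⟨ cong (charJet (punchInℕ 2)) (ℕP.+-comm 2 (3 + t)) ⟩
    charJet (punchInℕ 2) (3 + t + 2)
      ≡⟨ charJet-spine (punchInℕ 2) 2 (3 + t) 1 on-spine shifted below (3 + t) ℕP.≤-refl ⟩
    charJet (punchInℕ 2) 2 *ᴰ pathJet (3 + t)      ≡⟨ cong (_*ᴰ pathJet (3 + t)) (trans (charJet-cong 2 λ _ → punchInℕ-<)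
                                                         (spine-prefix 2 (s≤s (s≤s z≤n)))) ⟩
    pathJet 2 *ᴰ pathJet (3 + t)                   ∎
    where
    open ≡-Reasoning
    on-spine : ∀ x → x < 3 + t + 2 → punchInℕ 2 x < 6 + t
    on-spine x x< = ℕP.≤-<-trans (punchInℕ-≤ 2 x) (s≤s (subst (x <_) (ℕP.+-comm (3 + t) 2) x<))
    shifted : ∀ y → 2 ≤ y → y < 3 + t + 2 → punchInℕ 2 y ≡ y + 1
    shifted y 2≤y _ = trans (punchInℕ-≥ 2≤y) (ℕP.+-comm 1 y)
    below : ∀ y → y < 2 → suc (suc (punchInℕ 2 y)) ≤ 2 + 1
    below 0 _ = s≤s (s≤s z≤n)
    below 1 _ = ℕP.≤-refl
    below (suc (suc _)) (s≤s (s≤s ()))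

  spine-without-3+t : charJet without-3+t (5 + t) ≡ pathJet (3 + t) *ᴰ pathJet 2
  spine-without-3+t = begin
    charJet without-3+t (5 + t)                  ≡⟨ charJet-spine without-3+t (3 + t) 2 1 on-spine shifted below 2 ℕP.≤-refl ⟩
    charJet without-3+t (3 + t) *ᴰ pathJet 2     ≡⟨ cong (_*ᴰ pathJet 2) (trans (charJet-cong (3 + t) λ _ → punchInℕ-<)
                                              (spine-prefix (3 + t) (k+t≤m+t (ℕP.m≤m+n 3 3)))) ⟩
    pathJet (3 + t) *ᴰ pathJet 2        ∎
    where
    open ≡-Reasoning
    on-spine : ∀ x → x < 2 + (3 + t) → without-3+t x < 6 + t
    on-spine x x< = ℕP.≤-<-trans (without-3+t-≤ x) (s≤s x<)
    shifted : ∀ y → 3 + t ≤ y → y < 2 + (3 + t) → without-3+t y ≡ y + 1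
    shifted y 3+t≤y _ = trans (without-3+t-≥ 3+t≤y) (ℕP.+-comm 1 y)
    below : ∀ y → y < 3 + t → suc (suc (without-3+t y)) ≤ 3 + t + 1
    below y y<3+t = subst₂ (λ a b → suc (suc a) ≤ b) (sym (punchInℕ-< y<3+t)) (ℕP.+-comm 1 (3 + t)) (s≤s y<3+t)

  jet-charPoly-H : jet (charPoly (H (10 + t))) ≡ pathJet (6 + t) -ᴰ ε *ᴰ (pathJet (3 + t) +ᴰ pathJet (3 + t))
  jet-charPoly-H = begin
    jet (charPoly (H (10 + t)))
      ≡⟨ jet-charPoly (H (10 + t)) (adjH t) (λ _ _ → refl) ⟩
    detᴰ (order (H (10 + t))) (charMatrixᴰ (adjH t) id (order (H (10 + t))))
      ≡⟨ charJet-unfold id (order (H (10 + t))) ⟨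
    charJet id (order (H (10 + t)))
      ≡⟨ cong (charJet id) (trans (ℕP.+-assoc (6 + t) 2 2) (ℕP.+-comm (6 + t) 4)) ⟩
    charJet id (10 + t)
      ≡⟨ trans peel-9+t (cong₂ (λ x y → ε *ᴰ x -ᴰ y)
           (trans peel-8+t (cong₂ (λ x y → ε *ᴰ x -ᴰ y) A≡ B≡)) A≡) ⟩
    ε *ᴰ (ε *ᴰ A -ᴰ B) -ᴰ A
      ≡⟨ collapse a b (charJet (without-3+t ∘ punchInℕ 2) (4 + t)) ⟩
    a -ᴰ ε *ᴰ (b +ᴰ b)
      ∎
    where
    open ≡-Reasoning
    open DualSolver using (solve; _⊜_; _⊗_; ⊝_; Κ) renaming (_⊕_ to _⊞_)
    a = pathJet (6 + t)
    b = pathJet (3 + t)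
    p = pathJet 2
    A = ε *ᴰ (ε *ᴰ a -ᴰ p *ᴰ b) -ᴰ a
    B = ε *ᴰ (ε *ᴰ (b *ᴰ p) -ᴰ charJet (without-3+t ∘ punchInℕ 2) (4 + t)) -ᴰ b *ᴰ p
    A≡ : charJet id (8 + t) ≡ A
    A≡ = trans peel-7+t (cong₂ (λ x y → ε *ᴰ x -ᴰ y)
      (trans peel-6+t (cong₂ (λ x y → ε *ᴰ x -ᴰ y) (spine-prefix (6 + t) ℕP.≤-refl) spine-without-2))
      (spine-prefix (6 + t) ℕP.≤-refl))
    B≡ : charJet without-3+t (7 + t) ≡ B
    B≡ = trans peel-7+t-without-3+t (cong₂ (λ x y → ε *ᴰ x -ᴰ y)
      (trans peel-6+t-without-3+t (cong (λ x → ε *ᴰ x -ᴰ charJet (without-3+t ∘ punchInℕ 2) (4 + t)) spine-without-3+t))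
      spine-without-3+t)
    -- Every term with two factors ε vanishes, and ε · p = −ε.
    collapse : ∀ a b c →
      ε *ᴰ (ε *ᴰ (ε *ᴰ (ε *ᴰ a -ᴰ p *ᴰ b) -ᴰ a) -ᴰ (ε *ᴰ (ε *ᴰ (b *ᴰ p) -ᴰ c) -ᴰ b *ᴰ p))
        -ᴰ (ε *ᴰ (ε *ᴰ a -ᴰ p *ᴰ b) -ᴰ a)
      ≡ a -ᴰ ε *ᴰ (b +ᴰ b)
    collapse = solve 3 (λ a b c →
      (Κ ε ⊗ (Κ ε ⊗ (Κ ε ⊗ (Κ ε ⊗ a ⊞ ⊝ (Κ p ⊗ b)) ⊞ ⊝ a)
                ⊞ ⊝ (Κ ε ⊗ (Κ ε ⊗ (b ⊗ Κ p) ⊞ ⊝ c) ⊞ ⊝ (b ⊗ Κ p)))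
        ⊞ ⊝ (Κ ε ⊗ (Κ ε ⊗ a ⊞ ⊝ (Κ p ⊗ b)) ⊞ ⊝ a))
      ⊜ (a ⊞ ⊝ (Κ ε ⊗ (b ⊞ b)))) refl

subtract-2εb : ∀ a b → a -ᴰ ε *ᴰ (b +ᴰ b) ≡ dual (c₀ a) (c₁ a ℤ.- (c₀ b ℤ.+ c₀ b))
subtract-2εb (dual a₀ a₁) (dual b₀ b₁) = cong₂ dual (constant a₀ b₀) (linear a₁ b₀ b₁)
  where
  constant : ∀ a₀ b₀ → a₀ ℤ.+ ℤ.- (+ 0 ℤ.* (b₀ ℤ.+ b₀)) ≡ a₀
  constant = solve-∀
  linear : ∀ a₁ b₀ b₁ → a₁ ℤ.+ ℤ.- (+ 0 ℤ.* (b₁ ℤ.+ b₁) ℤ.+ + 1 ℤ.* (b₀ ℤ.+ b₀)) ≡ a₁ ℤ.- (b₀ ℤ.+ b₀)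
  linear = solve-∀

jet-charPoly-H-coefficients : ∀ t → jet (charPoly (H (10 + t))) ≡
  dual (c₀ (pathJet (6 + t))) (c₁ (pathJet (6 + t)) ℤ.- (c₀ (pathJet (3 + t)) ℤ.+ c₀ (pathJet (3 + t))))
jet-charPoly-H-coefficients t = trans (jet-charPoly-H t) (subtract-2εb (pathJet (6 + t)) (pathJet (3 + t)))

lowestTerm-H-degree₀ : ∀ t {a} → a ≢ + 0 → c₀ (pathJet (6 + t)) ≡ a →
  lowestTerm (charPoly (H (10 + t))) ≡ just (a , 0)
lowestTerm-H-degree₀ t a≢0 eq =
  lowestTerm-degree₀ (charPoly (H (10 + t))) a≢0 (trans (cong c₀ (jet-charPoly-H-coefficients t)) eq)

lowestTerm-H-degree₁ : ∀ t {b} → b ≢ + 0 → c₀ (pathJet (6 + t)) ≡ + 0 →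
  c₁ (pathJet (6 + t)) ℤ.- (c₀ (pathJet (3 + t)) ℤ.+ c₀ (pathJet (3 + t))) ≡ b →
  lowestTerm (charPoly (H (10 + t))) ≡ just (b , 1)
lowestTerm-H-degree₁ t b≢0 eq₀ eq₁ = lowestTerm-degree₁ (charPoly (H (10 + t))) b≢0
  (trans (cong c₀ (jet-charPoly-H-coefficients t)) eq₀) (trans (cong c₁ (jet-charPoly-H-coefficients t)) eq₁)

lowestTerm-H-4s : ∀ s → 10 ≤ 4 * s → lowestTerm (charPoly (H (4 * s))) ≡ just (+ 1 , 0)
lowestTerm-H-4s 0 10≤n = ⊥-elim (from-no (10 ℕ.≤? 0) 10≤n)
lowestTerm-H-4s 1 10≤n = ⊥-elim (from-no (10 ℕ.≤? 4) 10≤n)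
lowestTerm-H-4s 2 10≤n = ⊥-elim (from-no (10 ℕ.≤? 8) 10≤n)
lowestTerm-H-4s (suc (suc (suc q))) _ = subst (λ n → lowestTerm (charPoly (H n)) ≡ just (+ 1 , 0)) (sym (n≡ q))
  (lowestTerm-H-degree₀ (2 + q * 4) (λ ()) (cong c₀ (PathJetPeriod.at-4q (pathJet-period (2 + q)))))
  where
  n≡ : ∀ q → 4 * (3 + q) ≡ 10 + (2 + q * 4)
  n≡ = ℕ-Solver.solve-∀

lowestTerm-H-4s+1 : ∀ s → 10 ≤ 4 * s + 1 → lowestTerm (charPoly (H (4 * s + 1))) ≡ just (+ (2 * s + 1) , 1)
lowestTerm-H-4s+1 0 10≤n = ⊥-elim (from-no (10 ℕ.≤? 1) 10≤n)
lowestTerm-H-4s+1 1 10≤n = ⊥-elim (from-no (10 ℕ.≤? 5) 10≤n)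
lowestTerm-H-4s+1 2 10≤n = ⊥-elim (from-no (10 ℕ.≤? 9) 10≤n)
lowestTerm-H-4s+1 (suc (suc (suc q))) _ =
  subst (λ n → lowestTerm (charPoly (H n)) ≡ just (+ (2 * (3 + q) + 1) , 1)) (sym (n≡ q))
    (lowestTerm-H-degree₁ (3 + q * 4) (λ ()) (cong c₀ at-4q+1)
      (trans (cong₂ (λ a b → c₁ a ℤ.- (c₀ b ℤ.+ c₀ b)) at-4q+1 (PathJetPeriod.at-4q+2 (pathJet-period (1 + q))))
        (cong +_ (coefficient≡ q))))
  where
  open PathJetPeriod (pathJet-period (2 + q)) using (at-4q+1)
  n≡ : ∀ q → 4 * (3 + q) + 1 ≡ 10 + (3 + q * 4)
  n≡ = ℕ-Solver.solve-∀
  coefficient≡ : ∀ q → 1 + (2 + q) * 2 + 2 ≡ 2 * (3 + q) + 1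
  coefficient≡ = ℕ-Solver.solve-∀

lowestTerm-H-4s+2 : ∀ s → 10 ≤ 4 * s + 2 → lowestTerm (charPoly (H (4 * s + 2))) ≡ just (- (+ 1) , 0)
lowestTerm-H-4s+2 0 10≤n = ⊥-elim (from-no (10 ℕ.≤? 2) 10≤n)
lowestTerm-H-4s+2 1 10≤n = ⊥-elim (from-no (10 ℕ.≤? 6) 10≤n)
lowestTerm-H-4s+2 (suc (suc q)) _ = subst (λ n → lowestTerm (charPoly (H n)) ≡ just (- (+ 1) , 0)) (sym (n≡ q))
  (lowestTerm-H-degree₀ (q * 4) (λ ()) (cong c₀ (PathJetPeriod.at-4q+2 (pathJet-period (1 + q)))))
  where
  n≡ : ∀ q → 4 * (2 + q) + 2 ≡ 10 + q * 4
  n≡ = ℕ-Solver.solve-∀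

lowestTerm-H-4s+3 : ∀ s → 10 ≤ 4 * s + 3 → lowestTerm (charPoly (H (4 * s + 3))) ≡ just (- (+ (2 * s + 2)) , 1)
lowestTerm-H-4s+3 0 10≤n = ⊥-elim (from-no (10 ℕ.≤? 3) 10≤n)
lowestTerm-H-4s+3 1 10≤n = ⊥-elim (from-no (10 ℕ.≤? 7) 10≤n)
lowestTerm-H-4s+3 (suc (suc q)) _ =
  subst (λ n → lowestTerm (charPoly (H n)) ≡ just (- (+ (2 * (2 + q) + 2)) , 1)) (sym (n≡ q))
    (lowestTerm-H-degree₁ (1 + q * 4) (λ ()) (cong c₀ at-4q+3)
      (trans (cong₂ (λ a b → c₁ a ℤ.- (c₀ b ℤ.+ c₀ b)) at-4q+3 at-4q)
        (trans (sym (ℤP.neg-distrib-+ (+ (2 + (1 + q) * 2)) (+ 2))) (cong (λ m → - (+ m)) (coefficient≡ q)))))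
  where
  open PathJetPeriod (pathJet-period (1 + q)) using (at-4q; at-4q+3)
  n≡ : ∀ q → 4 * (2 + q) + 3 ≡ 10 + (1 + q * 4)
  n≡ = ℕ-Solver.solve-∀
  coefficient≡ : ∀ q → 2 + (1 + q) * 2 + 2 ≡ 2 * (2 + q) + 2
  coefficient≡ = ℕ-Solver.solve-∀

proposition2p17 : (∀ s → 10 ≤ 4 * s → lowestTerm (charPoly (H (4 * s))) ≡ just (+ 1 , 0))
    × (∀ s → 10 ≤ 4 * s + 1 → lowestTerm (charPoly (H (4 * s + 1))) ≡ just (+ (2 * s + 1) , 1))
    × (∀ s → 10 ≤ 4 * s + 2 → lowestTerm (charPoly (H (4 * s + 2))) ≡ just (- (+ 1) , 0))
    × (∀ s → 10 ≤ 4 * s + 3 → lowestTerm (charPoly (H (4 * s + 3))) ≡ just (- (+ (2 * s + 2)) , 1))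
proposition2p17 = lowestTerm-H-4s , lowestTerm-H-4s+1 , lowestTerm-H-4s+2 , lowestTerm-H-4s+3
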